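{- Let $q$ be a prime power. The class of targets over $GF(q)$ is closed under induced minors: if $M$ is a target over $GF(q)$ and $N$ is an induced minor of $M$, then $N$ is a target over $GF(q)$.
   Context: All matroids are simple, and contracting an element is always followed by simplification. $PG(r-1,q)$ denotes the rank-$r$ projective geometry over $GF(q)$. For $X\subseteq E(PG(r-1,q))$, $PG(r-1,q)|X$ is a target if there is a sequence $(F_0,\dots,F_k)$ of possibly empty flats of $PG(r-1,q)$ with $\emptyset=F_0\subseteq F_1\subseteq\dots\subseteq F_k=E(PG(r-1,q))$ such that $X$ is the union of the sets $F_{i+1}-F_i$ over all even $i$ with $0\le i\le k-1$. A simple matroid $M$ is a target over $GF(q)$ if $M\cong PG(r-1,q)|X$ for some $r$ and some $X$ with $PG(r-1,q)|X$ a target. An induced restriction of $M$ is a restriction of $M$ to one of its flats. A simple matroid $N$ is an induced minor of a simple matroid $M$ if $N$ can be obtained from $M$ by a sequence of (simplified) contractions and induced restrictions. -}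

module Defs where

open import Level using () renaming (suc to lsuc; zero to lzero)
open import Data.Nat using (ℕ; zero; suc; _<_; _≤_; _*_; _^_)
open import Data.Nat.Primality using (Prime)
open import Data.Fin using (Fin) renaming (zero to fzero; suc to fsuc)
open import Data.Fin.Subset using (Subset; _∈_; _∉_; _⊆_; _∪_; ⁅_⁆; ∣_∣)
open import Data.Vec.Base using (tabulate; lookup)
open import Data.Product using (Σ; ∃; ∃-syntax; _×_; _,_)
open import Data.Sum using (_⊎_)
open import Relation.Nullary using (¬_)
open import Relation.Binary.PropositionalEquality using (_≡_; _≢_)
open import Function.Definitions using (Injective)
open import Function.Bundles using (_⇔_)

IsPrimePower : ℕ → Set
IsPrimePower q = ∃[ p ] ∃[ k ] (Prime p × 1 ≤ k × q ≡ p ^ k)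

-- A finite field of order q, with carrier Fin q (so it is GF(q) up to
-- isomorphism).  Equality is propositional equality.

record FiniteField (q : ℕ) : Set where
  infixl 6 _+F_
  infixl 7 _*F_
  field
    _+F_ _*F_ : Fin q → Fin q → Fin q
    -F_       : Fin q → Fin q
    0F 1F     : Fin q
    +-assoc   : ∀ a b c → (a +F b) +F c ≡ a +F (b +F c)
    +-comm    : ∀ a b → a +F b ≡ b +F a
    +-identity : ∀ a → 0F +F a ≡ a
    +-inverse : ∀ a → (-F a) +F a ≡ 0F
    *-assoc   : ∀ a b c → (a *F b) *F c ≡ a *F (b *F c)
    *-comm    : ∀ a b → a *F b ≡ b *F a
    *-identity : ∀ a → 1F *F a ≡ a
    distrib   : ∀ a b c → a *F (b +F c) ≡ (a *F b) +F (a *F c)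
    0≢1       : 0F ≢ 1F
    *-inverse : ∀ a → a ≢ 0F → ∃[ b ] (b *F a ≡ 1F)

IndepPred : ℕ → Set₁
IndepPred n = Subset n → Set

InCl : ∀ {n} → IndepPred n → Subset n → Fin n → Set
InCl Ind X e = e ∈ X ⊎ ∃[ I ] (I ⊆ X × Ind I × ¬ Ind (I ∪ ⁅ e ⁆))

IsFlatP : ∀ {n} → IndepPred n → Subset n → Set
IsFlatP Ind X = ∀ e → InCl Ind X e → e ∈ X

preimage : ∀ {m n} → (Fin m → Fin n) → Subset n → Subset m
preimage φ I = tabulate (λ i → lookup I (φ i))

IsoToRestriction : ∀ {m n} → IndepPred m → IndepPred n → Subset n → Set
IsoToRestriction {m} {n} IndN IndM X =
  ∃[ φ ] (Injective _≡_ _≡_ φ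
         × (∀ (j : Fin n) → (j ∈ X ⇔ (∃[ i ] φ i ≡ j)))
         × (∀ I → I ⊆ X → (IndM I ⇔ IndN (preimage φ I))))

record Matroid (n : ℕ) : Set₁ where
  field
    Indep     : Subset n → Set
    indep-∅   : ∀ I → (∀ e → e ∉ I) → Indep I
    indep-⊆   : ∀ {I J} → J ⊆ I → Indep I → Indep J
    indep-aug : ∀ {I J} → Indep I → Indep J → ∣ I ∣ < ∣ J ∣ →
                ∃[ e ] (e ∈ J × e ∉ I × Indep (I ∪ ⁅ e ⁆))
    -- simple: no loops and no parallel pairs
    simple    : ∀ e f → Indep (⁅ e ⁆ ∪ ⁅ f ⁆)

open Matroid public

IsFlat : ∀ {n} → Matroid n → Subset n → Set
IsFlat M = IsFlatP (Indep M)

IsInducedRestriction : ∀ {m n} → Matroid m → Matroid n → Set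
IsInducedRestriction N M = ∃[ F ] (IsFlat M F × IsoToRestriction (Indep N) (Indep M) F)

-- In M/e a set I avoiding e is independent iff I ∪ {e} is independent in M.
-- X ⊆ E(M) - e is a set of representatives of the parallel classes of
-- M/e (M is simple, so M/e has no loops), and si(M/e) = (M/e)|X.
IsSimpleContraction : ∀ {m n} → Matroid m → Matroid n → Set
IsSimpleContraction N M =
  ∃[ e ] ∃[ X ]
    ( e ∉ X
    × (∀ f → f ≢ e → ∃[ x ] (x ∈ X × (f ≡ x ⊎ ¬ Indep M (⁅ e ⁆ ∪ ⁅ f ⁆ ∪ ⁅ x ⁆))))
    × (∀ x y → x ∈ X → y ∈ X → x ≢ y → Indep M (⁅ e ⁆ ∪ ⁅ x ⁆ ∪ ⁅ y ⁆))
    × IsoToRestriction (Indep N) (λ I → Indep M (I ∪ ⁅ e ⁆)) X )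

data InducedMinor : ∀ {m n} → Matroid m → Matroid n → Set₁ where
  im-refl : ∀ {n} (M : Matroid n) → InducedMinor M M
  im-restr : ∀ {k m n} {N : Matroid k} {L : Matroid m} {M : Matroid n} →
             InducedMinor L M → IsInducedRestriction N L → InducedMinor N M
  im-contr : ∀ {k m n} {N : Matroid k} {L : Matroid m} {M : Matroid n} →
             InducedMinor L M → IsSimpleContraction N L → InducedMinor N M

module _ {q : ℕ} (𝔽 : FiniteField q) where
  open FiniteField 𝔽

  sumF : ∀ {n} → (Fin n → Fin q) → Fin q
  sumF {zero}  f = 0F
  sumF {suc n} f = f fzero +F sumF (λ i → f (fsuc i))

  LinIndep : ∀ {n r} → (Fin n → Fin r → Fin q) → Subset n → Set
  LinIndep {n} v I =
    ∀ (c : Fin n → Fin q) → (∀ i → i ∉ I → c i ≡ 0F) →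
    (∀ k → sumF (λ i → c i *F v i k) ≡ 0F) → ∀ i → c i ≡ 0F

  -- v : Fin n → GF(q)^r lists exactly one nonzero vector from each
  -- 1-dimensional subspace, so (Fin n, LinIndep v) is PG(r-1,q).
  IsPG : ∀ {n} (r : ℕ) → (Fin n → Fin r → Fin q) → Set
  IsPG {n} r v =
      (∀ i → ∃[ k ] v i k ≢ 0F)
    × (∀ i j (c : Fin q) → (∀ k → v j k ≡ c *F v i k) → i ≡ j)
    × (∀ (w : Fin r → Fin q) → (∃[ k ] w k ≢ 0F) →
         ∃[ i ] ∃[ c ] (∀ k → w k ≡ c *F v i k))

  -- PG(r-1,q)|X is a target: a chain of flats ∅ = F 0 ⊆ … ⊆ F k = E with
  -- X the union of F (i+1) - F i over even i < k.
  IsTargetSet : ∀ {n r} → (Fin n → Fin r → Fin q) → Subset n → Set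
  IsTargetSet {n} v X =
    ∃[ k ] Σ (ℕ → Subset n) λ F → (
        (∀ e → e ∉ F 0)
      × (∀ e → e ∈ F k)
      × (∀ i → i < k → F i ⊆ F (suc i))
      × (∀ i → i ≤ k → IsFlatP (LinIndep v) (F i))
      × (∀ e → (e ∈ X ⇔ (∃[ i ] (i < k × (∃[ j ] i ≡ 2 * j) × e ∈ F (suc i) × e ∉ F i)))))

  IsTarget : ∀ {m} → Matroid m → Set
  IsTarget M =
    ∃[ r ] ∃[ n ] ∃[ v ] (IsPG {n} r v × ∃[ X ] (IsTargetSet v X × IsoToRestriction (Indep M) (LinIndep v) X))

module Submission where

-- Both operations stay inside the ambient geometry PG(r-1,q), with M ≅ PG|X.
-- Restriction to a flat F of M: the span W of the image of F is a flat of the geometry whose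
-- intersection with X is that image, and intersecting the chain of flats of X with W gives a
-- chain for X ∩ W.
-- Contraction of e ∈ X: project X - e from e onto a hyperplane H ∌ e. Two points have the
-- same projection exactly when they are dependent together with e, so the representatives
-- chosen by the simplification project injectively, and I ∪ {e} is independent iff the
-- projection of I is. If e lies in the even layer j of the chain F, the flats F (1 + t + j) ∩ H,
-- preceded by ∅, form a chain for the projection of X - e.
-- A chain that falls short of the whole geometry is completed by one step at an odd index.

open import Defs
open import Level using (0ℓ)
open import Algebra.Bundles using (CommutativeRing)
import Algebra.Properties.Ring as RingProperties
import Algebra.Properties.Semiring.Sum as SumProperties
open import Data.Bool using (true)
open import Data.Fin using (Fin; _≟_) renaming (zero to fzero; suc to fsuc)
open import Data.Fin.Base using (finToFun; funToFin; punchIn)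
open import Data.Fin.Properties using (any?; all?; finToFun-funToFin; punchInᵢ≢i; ¬∀⟶∃¬)
open import Data.Fin.Subset using (Subset; _∈_; _∉_; _⊆_; _∪_; _∩_; _─_; _-_; ⁅_⁆; ⊥; ⊤; outside)
open import Data.Fin.Subset.Properties
  using ( _∈?_; ∉⊥; ∈⊤; ⊆⊤; ⊆-antisym; x∈⁅x⁆; x∈⁅y⁆⇒x≡y; x≢y⇒x∉⁅y⁆
        ; x∈p∪q⁻; x∈p∪q⁺; p⊆p∪q; q⊆p∪q; x∈p∩q⁺; p∩q⊆p; p∩q⊆q; p─q⊆p; x∈p∧x≢y⇒x∈p-y )
open import Data.List using ([]; _∷_; allFin)
open import Data.List.Membership.Propositional using () renaming (_∈_ to _∈ₗ_)
open import Data.List.Membership.Propositional.Properties using (∈-allFin)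
open import Data.List.Relation.Unary.Any using (here; there)
open import Data.Nat as Nat using (ℕ; zero; suc; _<_; _≤_; _⊓_; _≤?_; _<?_; s≤s; z≤n)
open import Data.Nat.Properties
  using ( ≤-trans; <⇒≤; ≤-pred; n≤1+n; ≮⇒≥; 1+n≰n; m≤m+n; m≤n⇒m≤1+n; m≤n⇒m<n∨m≡n
        ; m≤n⇒m⊓n≡m; m≥n⇒m⊓n≡n; m⊓n≤n; ⊓-monoˡ-≤; even≢odd
        ; m≤o∸n⇒m+n≤o; m<n⇒0<n∸m; ∸-monoˡ-<; m∸n+n≡m; *-distribˡ-∸; *-distribˡ-+ )
open import Data.Product using (∃; ∃-syntax; Σ; _×_; _,_; proj₁; proj₂)
open import Data.Sum using (_⊎_; inj₁; inj₂; [_,_])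
open import Data.Vec using (_∷_; here; there; lookup; tabulate)
open import Data.Vec.Properties using (lookup∘tabulate; []=⇒lookup; lookup⇒[]=)
open import Function using (_∘_; id; flip; case_of_)
open import Function.Bundles using (_⇔_; mk⇔; Equivalence)
open import Function.Definitions using (Injective)
open import Function.Properties.Equivalence using (⇔-setoid) renaming (trans to ⇔-trans; sym to ⇔-sym)
open import Relation.Nullary using (¬_; Dec; yes; no; does; contradiction)
open import Relation.Nullary.Decidable using (¬?; _×-dec_; _→-dec_; map′; decidable-stable)
open import Relation.Unary using (Pred; Decidable)
open import Relation.Binary.PropositionalEquality hiding ([_])
import Relation.Binary.Reasoning.Setoid as SetoidReasoning

module FieldProperties {q : ℕ} (𝔽 : FiniteField q) where
  open FiniteField 𝔽 using (_+F_; _*F_; -F_; 0F; 1F; 0≢1; *-inverse)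

  commutativeRing : CommutativeRing 0ℓ 0ℓ
  commutativeRing = record
    { Carrier = Fin q ; _≈_ = _≡_ ; _+_ = _+F_ ; _*_ = _*F_ ; -_ = -F_ ; 0# = 0F ; 1# = 1F
    ; isCommutativeRing = record
      { isRing = record
        { +-isAbelianGroup = record
          { isGroup = record
            { isMonoid = record
              { isSemigroup = record
                { isMagma = record { isEquivalence = isEquivalence ; ∙-cong = cong₂ _+F_ }
                ; assoc = F.+-assoc }
              ; identity = F.+-identity , λ a → trans (F.+-comm a 0F) (F.+-identity a) }
            ; inverse = F.+-inverse , λ a → trans (F.+-comm a (-F a)) (F.+-inverse a)
            ; ⁻¹-cong = cong -F_ }
          ; comm = F.+-comm }
        ; *-cong = cong₂ _*F_
        ; *-assoc = F.*-assoc
        ; *-identity = F.*-identity , λ a → trans (F.*-comm a 1F) (F.*-identity a)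
        ; distrib = F.distrib , λ a b c → trans (F.*-comm (b +F c) a)
                      (trans (F.distrib a b c) (cong₂ _+F_ (F.*-comm a b) (F.*-comm a c))) }
      ; *-comm = F.*-comm } }
    where module F = FiniteField 𝔽

  open ≡-Reasoning

  open CommutativeRing commutativeRing public
    hiding (refl; sym; trans; reflexive; isEquivalence; setoid; _-_; zero)
  open RingProperties ring public
  open SumProperties semiring public
    using (sum; sum-cong-≗; sum-remove; ∑-distrib-+; ∑-comm; *-distribˡ-sum; *-distribʳ-sum; sum-replicate-zero)

  sumF≡sum : ∀ {n} (f : Fin n → Carrier) → sumF 𝔽 f ≡ sum f
  sumF≡sum {zero} f = refl
  sumF≡sum {suc n} f = cong (f fzero +_) (sumF≡sum (λ i → f (fsuc i)))

  1≢0 : 1# ≢ 0#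
  1≢0 = 0≢1 ∘ sym

  inverse : ∀ a → a ≢ 0# → Carrier
  inverse a a≢0 = proj₁ (*-inverse a a≢0)

  inverse-inverseˡ : ∀ a (a≢0 : a ≢ 0#) → inverse a a≢0 * a ≡ 1#
  inverse-inverseˡ a a≢0 = proj₂ (*-inverse a a≢0)

  inverse-cancelˡ : ∀ a (a≢0 : a ≢ 0#) b → inverse a a≢0 * (a * b) ≡ b
  inverse-cancelˡ a a≢0 b = begin
    inverse a a≢0 * (a * b)  ≡⟨ *-assoc _ a b ⟨
    (inverse a a≢0 * a) * b  ≡⟨ cong (_* b) (inverse-inverseˡ a a≢0) ⟩
    1# * b                   ≡⟨ *-identityˡ b ⟩
    b                        ∎

  x≢0∧x*y≡0⇒y≡0 : ∀ {x y} → x ≢ 0# → x * y ≡ 0# → y ≡ 0#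
  x≢0∧x*y≡0⇒y≡0 {x} {y} x≢0 xy≡0 = begin
    y                        ≡⟨ inverse-cancelˡ x x≢0 y ⟨
    inverse x x≢0 * (x * y)  ≡⟨ cong (inverse x x≢0 *_) xy≡0 ⟩
    inverse x x≢0 * 0#       ≡⟨ zeroʳ _ ⟩
    0#                       ∎

  *-≢0 : ∀ {x y} → x ≢ 0# → y ≢ 0# → x * y ≢ 0#
  *-≢0 x≢0 y≢0 = y≢0 ∘ x≢0∧x*y≡0⇒y≡0 x≢0

  inverse-≢0 : ∀ a (a≢0 : a ≢ 0#) → inverse a a≢0 ≢ 0#
  inverse-≢0 a a≢0 a⁻¹≡0 = 1≢0 (begin
    1#                 ≡⟨ inverse-inverseˡ a a≢0 ⟨
    inverse a a≢0 * a  ≡⟨ cong (_* a) a⁻¹≡0 ⟩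
    0# * a             ≡⟨ zeroˡ a ⟩
    0#                 ∎)

  sum-zero : ∀ {n} {f : Fin n → Carrier} → (∀ i → f i ≡ 0#) → sum f ≡ 0#
  sum-zero {n} f≡0 = trans (sum-cong-≗ f≡0) (sum-replicate-zero n)

  sum-single : ∀ {n} (f : Fin n → Carrier) x → (∀ i → i ≢ x → f i ≡ 0#) → sum f ≡ f x
  sum-single {suc n} f x f≡0 = begin
    sum f                     ≡⟨ sum-remove f ⟩
    f x + sum (f ∘ punchIn x) ≡⟨ cong (f x +_) (sum-zero (λ j → f≡0 _ (punchInᵢ≢i x j))) ⟩
    f x + 0#                  ≡⟨ +-identityʳ (f x) ⟩
    f x                       ∎

∃-fun? : ∀ {m k} {P : (Fin m → Fin k) → Set} →
         (∀ {c c′} → c ≗ c′ → P c → P c′) → Decidable P → Dec (∃ P)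
∃-fun? resp P? = map′ (λ (x , p) → finToFun x , p)
                      (λ (c , p) → funToFin c , resp (sym ∘ finToFun-funToFin c) p)
                      (any? (P? ∘ finToFun))

module _ {n : ℕ} {P : Pred (Fin n) 0ℓ} (P? : Decidable P) where

  subsetOf : Subset n
  subsetOf = tabulate (does ∘ P?)

  ∈-subsetOf⁻ : ∀ {x} → x ∈ subsetOf → P x
  ∈-subsetOf⁻ {x} x∈ with P? x | trans (sym (lookup∘tabulate (does ∘ P?) x)) ([]=⇒lookup x∈)
  ... | yes px | _  = px
  ... | no _   | ()

  ∈-subsetOf⁺ : ∀ {x} → P x → x ∈ subsetOf
  ∈-subsetOf⁺ {x} px = lookup⇒[]= x _ (trans (lookup∘tabulate _ x) (does-yes (P? x)))
    where
    does-yes : ∀ d → does d ≡ true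
    does-yes (yes _)  = refl
    does-yes (no ¬px) = contradiction px ¬px

module _ {m n : ℕ} (φ : Fin m → Fin n) where

  ∈-preimage⁻ : ∀ {I i} → i ∈ preimage φ I → φ i ∈ I
  ∈-preimage⁻ {I} {i} i∈ =
    lookup⇒[]= (φ i) I (trans (sym (lookup∘tabulate (lookup I ∘ φ) i)) ([]=⇒lookup i∈))

  ∈-preimage⁺ : ∀ {I i} → φ i ∈ I → i ∈ preimage φ I
  ∈-preimage⁺ {I} {i} φi∈ = lookup⇒[]= i _ (trans (lookup∘tabulate (lookup I ∘ φ) i) ([]=⇒lookup φi∈))

  image : Subset m → Subset n
  image F = subsetOf (λ y → any? (λ x → (x ∈? F) ×-dec (φ x ≟ y)))

  ∈-image⁻ : ∀ {F y} → y ∈ image F → ∃[ x ] (x ∈ F × φ x ≡ y)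
  ∈-image⁻ {F} = ∈-subsetOf⁻ (λ y → any? (λ x → (x ∈? F) ×-dec (φ x ≟ y)))

  ∈-image⁺ : ∀ {F x} → x ∈ F → φ x ∈ image F
  ∈-image⁺ {F} {x} x∈F = ∈-subsetOf⁺ (λ y → any? (λ x → (x ∈? F) ×-dec (φ x ≟ y))) (x , x∈F , refl)

preimage-∘ : ∀ {k m n} (φ : Fin k → Fin m) (ψ : Fin m → Fin n) (I : Subset n) →
             preimage φ (preimage ψ I) ≡ preimage (ψ ∘ φ) I
preimage-∘ φ ψ I = ⊆-antisym
  (∈-preimage⁺ (ψ ∘ φ) {I} ∘ ∈-preimage⁻ ψ {I} ∘ ∈-preimage⁻ φ {preimage ψ I})
  (∈-preimage⁺ φ {preimage ψ I} ∘ ∈-preimage⁺ ψ {I} ∘ ∈-preimage⁻ (ψ ∘ φ) {I})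

module _ {n : ℕ} where

  ∪-⊆ : {A B C : Subset n} → A ⊆ C → B ⊆ C → A ∪ B ⊆ C
  ∪-⊆ {A} {B} A⊆C B⊆C x∈A∪B = [ A⊆C , B⊆C ] (x∈p∪q⁻ A B x∈A∪B)

  ⊆-∩ : {A B C : Subset n} → A ⊆ B → A ⊆ C → A ⊆ B ∩ C
  ⊆-∩ A⊆B A⊆C x∈A = x∈p∩q⁺ (A⊆B x∈A , A⊆C x∈A)

  x≡y⇒x∈⁅y⁆ : {x y : Fin n} → x ≡ y → x ∈ ⁅ y ⁆
  x≡y⇒x∈⁅y⁆ {x} refl = x∈⁅x⁆ x

  ∉-∪ : {A B : Subset n} {x : Fin n} → x ∉ A → x ∉ B → x ∉ A ∪ B
  ∉-∪ {A} {B} x∉A x∉B x∈A∪B = [ x∉A , x∉B ] (x∈p∪q⁻ A B x∈A∪B)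

  ⁅⁆-⊆ : {x : Fin n} {C : Subset n} → x ∈ C → ⁅ x ⁆ ⊆ C
  ⁅⁆-⊆ {x} {C} x∈C y∈⁅x⁆ = subst (_∈ C) (sym (x∈⁅y⁆⇒x≡y x y∈⁅x⁆)) x∈C

x∈p─q⇒x∉q : ∀ {n} {p q : Subset n} {x} → x ∈ p ─ q → x ∉ q
x∈p─q⇒x∉q {p = _ ∷ _} {outside ∷ _} here        ()
x∈p─q⇒x∉q {p = _ ∷ _} {_ ∷ _}       (there x∈) (there x∈q) = x∈p─q⇒x∉q x∈ x∈q

x∈p-y⇒x≢y : ∀ {n} {p : Subset n} {x y} → x ∈ p - y → x ≢ y
x∈p-y⇒x≢y {y = y} x∈ refl = x∈p─q⇒x∉q x∈ (x∈⁅x⁆ y)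

-- Spans, dependence and flats of a vector configuration

module LinearAlgebra {q : ℕ} (𝔽 : FiniteField q) {n r : ℕ} (v : Fin n → Fin r → Fin q) where
  open FieldProperties 𝔽
  open ≡-Reasoning

  lincomb : (Fin n → Carrier) → Fin r → Carrier
  lincomb c k = sum (λ i → c i * v i k)

  SupportedOn : Subset n → (Fin n → Carrier) → Set
  SupportedOn I c = ∀ i → i ∉ I → c i ≡ 0#

  Represents : Subset n → (Fin r → Carrier) → (Fin n → Carrier) → Set
  Represents I w c = SupportedOn I c × w ≗ lincomb c

  Span : Subset n → (Fin r → Carrier) → Set
  Span I w = ∃ (Represents I w)

  IsDependence : Subset n → (Fin n → Carrier) → Set
  IsDependence I c = SupportedOn I c × (∀ k → lincomb c k ≡ 0#) × ∃[ i ] c i ≢ 0#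

  Dependent : Subset n → Set
  Dependent I = ∃ (IsDependence I)

  Independent : Subset n → Set
  Independent = LinIndep 𝔽 v

  single : Fin n → Carrier → Fin n → Carrier
  single x a i with i ≟ x
  ... | yes _ = a
  ... | no _  = 0#

  single-≡ : ∀ x a → single x a x ≡ a
  single-≡ x a with x ≟ x
  ... | yes _  = refl
  ... | no x≢x = contradiction refl x≢x

  single-≢ : ∀ {x i} a → i ≢ x → single x a i ≡ 0#
  single-≢ {x} {i} a i≢x with i ≟ x
  ... | yes i≡x = contradiction i≡x i≢x
  ... | no _    = refl

  lincomb-cong : ∀ {c c′} → c ≗ c′ → lincomb c ≗ lincomb c′
  lincomb-cong c≗c′ k = sum-cong-≗ {n} (λ i → cong (_* v i k) (c≗c′ i))

  lincomb-+ : ∀ c d k → lincomb (λ i → c i + d i) k ≡ lincomb c k + lincomb d k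
  lincomb-+ c d k = trans (sum-cong-≗ {n} (λ i → distribʳ (v i k) (c i) (d i)))
                          (∑-distrib-+ (λ i → c i * v i k) (λ i → d i * v i k))

  lincomb-* : ∀ a c k → lincomb (λ i → a * c i) k ≡ a * lincomb c k
  lincomb-* a c k = trans (sum-cong-≗ {n} (λ i → *-assoc a (c i) (v i k)))
                          (sym (*-distribˡ-sum a (λ i → c i * v i k)))

  lincomb-single : ∀ x a k → lincomb (single x a) k ≡ a * v x k
  lincomb-single x a k = trans
    (sum-single (λ i → single x a i * v i k) x (λ i i≢x → trans (cong (_* v i k) (single-≢ a i≢x)) (zeroˡ _)))
    (cong (_* v x k) (single-≡ x a))

  supportedOn-resp : ∀ {I c c′} → c ≗ c′ → SupportedOn I c → SupportedOn I c′
  supportedOn-resp c≗c′ supp i i∉I = trans (sym (c≗c′ i)) (supp i i∉I)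

  isDependence-resp : ∀ {I c c′} → c ≗ c′ → IsDependence I c → IsDependence I c′
  isDependence-resp c≗c′ (supp , lc≡0 , i , ci≢0) =
    supportedOn-resp c≗c′ supp , (λ k → trans (sym (lincomb-cong c≗c′ k)) (lc≡0 k)) ,
    i , ci≢0 ∘ trans (c≗c′ i)

  represents-resp : ∀ {I w c c′} → c ≗ c′ → Represents I w c → Represents I w c′
  represents-resp c≗c′ (supp , w≗) =
    supportedOn-resp c≗c′ supp , (λ k → trans (w≗ k) (lincomb-cong c≗c′ k))

  supportedOn? : ∀ I c → Dec (SupportedOn I c)
  supportedOn? I c = all? (λ i → ¬? (i ∈? I) →-dec (c i ≟ 0#))

  dependent? : ∀ I → Dec (Dependent I)
  dependent? I = ∃-fun? isDependence-resp (λ c →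
    supportedOn? I c ×-dec all? (λ k → lincomb c k ≟ 0#) ×-dec any? (λ i → ¬? (c i ≟ 0#)))

  span? : ∀ I w → Dec (Span I w)
  span? I w = ∃-fun? represents-resp (λ c → supportedOn? I c ×-dec all? (λ k → w k ≟ lincomb c k))

  dependent⇒¬independent : ∀ {I} → Dependent I → ¬ Independent I
  dependent⇒¬independent (c , supp , lc≡0 , i , ci≢0) ind =
    ci≢0 (ind c supp (λ k → trans (sumF≡sum (λ i → c i * v i k)) (lc≡0 k)) i)

  ¬dependent⇒independent : ∀ {I} → ¬ Dependent I → Independent I
  ¬dependent⇒independent ¬dep c supp lc≡0 i with c i ≟ 0#
  ... | yes ci≡0 = ci≡0
  ... | no ci≢0  = contradiction
    (c , supp , (λ k → trans (sym (sumF≡sum (λ i → c i * v i k))) (lc≡0 k)) , i , ci≢0) ¬dep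

  ¬independent⇒dependent : ∀ {I} → ¬ Independent I → Dependent I
  ¬independent⇒dependent {I} ¬ind = decidable-stable (dependent? I) (¬ind ∘ ¬dependent⇒independent)

  independent? : ∀ I → Dec (Independent I)
  independent? I = map′ ¬dependent⇒independent (λ ind dep → dependent⇒¬independent dep ind) (¬? (dependent? I))

  independent-⊥ : Independent ⊥
  independent-⊥ c supp _ i = supp i ∉⊥

  independent-mono : ∀ {I J} → J ⊆ I → Independent I → Independent J
  independent-mono J⊆I ind c supp = ind c (λ i i∉I → supp i (i∉I ∘ J⊆I))

  span-mono : ∀ {I J w} → I ⊆ J → Span I w → Span J w
  span-mono I⊆J (c , supp , w≗) = c , (λ i i∉J → supp i (i∉J ∘ I⊆J)) , w≗

  span-∈ : ∀ {I i} → i ∈ I → Span I (v i)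
  span-∈ {I} {i} i∈I =
    single i 1# , (λ j j∉I → single-≢ 1# (λ j≡i → j∉I (subst (_∈ I) (sym j≡i) i∈I))) ,
    (λ k → sym (trans (lincomb-single i 1# k) (*-identityˡ _)))

  span-trans : ∀ {S T w} → (∀ {i} → i ∈ T → Span S (v i)) → Span T w → Span S w
  span-trans {S} {T} {w} spanS (t , t-supp , w≗) = c , c-supp , λ k → trans (w≗ k) (sym (lincomb-c k))
    where
    coefficients : ∀ i → Dec (i ∈ T) → Fin n → Carrier
    coefficients i (yes i∈T) = proj₁ (spanS i∈T)
    coefficients i (no _)    = λ _ → 0#

    d : Fin n → Fin n → Carrier
    d i = coefficients i (i ∈? T)

    d-supp : ∀ i → SupportedOn S (d i)
    d-supp i with i ∈? T
    ... | yes i∈T = proj₁ (proj₂ (spanS i∈T))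
    ... | no _    = λ _ _ → refl

    t*d : ∀ i k → t i * lincomb (d i) k ≡ t i * v i k
    t*d i k with i ∈? T
    ... | yes i∈T = cong (t i *_) (sym (proj₂ (proj₂ (spanS i∈T)) k))
    ... | no i∉T  = begin
      t i * lincomb (λ _ → 0#) k  ≡⟨ cong (_* _) (t-supp i i∉T) ⟩
      0# * lincomb (λ _ → 0#) k   ≡⟨ zeroˡ _ ⟩
      0#                          ≡⟨ zeroˡ _ ⟨
      0# * v i k                  ≡⟨ cong (_* v i k) (t-supp i i∉T) ⟨
      t i * v i k                 ∎

    c : Fin n → Carrier
    c j = sum (λ i → t i * d i j)

    c-supp : SupportedOn S c
    c-supp j j∉S = sum-zero (λ i → trans (cong (t i *_) (d-supp i j j∉S)) (zeroʳ (t i)))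

    lincomb-c : ∀ k → lincomb c k ≡ lincomb t k
    lincomb-c k = begin
      sum (λ j → sum (λ i → t i * d i j) * v j k)
        ≡⟨ sum-cong-≗ {n} (λ j → *-distribʳ-sum (v j k) (λ i → t i * d i j)) ⟩
      sum (λ j → sum (λ i → (t i * d i j) * v j k))
        ≡⟨ ∑-comm (λ i j → (t i * d i j) * v j k) ⟨
      sum (λ i → sum (λ j → (t i * d i j) * v j k))
        ≡⟨ sum-cong-≗ {n} (λ i → sum-cong-≗ {n} (λ j → *-assoc (t i) (d i j) (v j k))) ⟩
      sum (λ i → sum (λ j → t i * (d i j * v j k)))
        ≡⟨ sum-cong-≗ {n} (λ i → *-distribˡ-sum (t i) (λ j → d i j * v j k)) ⟨
      sum (λ i → t i * lincomb (d i) k)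
        ≡⟨ sum-cong-≗ {n} (λ i → t*d i k) ⟩
      lincomb t k
        ∎

  lincomb-neg : ∀ c k → lincomb (λ i → - c i) k ≡ - lincomb c k
  lincomb-neg c k = begin
    lincomb (λ i → - c i) k       ≡⟨ lincomb-cong (λ i → -1*x≈-x (c i)) k ⟨
    lincomb (λ i → - 1# * c i) k  ≡⟨ lincomb-* (- 1#) c k ⟩
    - 1# * lincomb c k            ≡⟨ -1*x≈-x _ ⟩
    - lincomb c k                 ∎

  dependence⇒span : ∀ {S c a} → SupportedOn S c → (∀ k → lincomb c k ≡ 0#) →
                    c a ≢ 0# → Span (S - a) (v a)
  dependence⇒span {S} {c} {a} supp lc≡0 ca≢0 = d , d-supp , λ k → sym (lincomb-d k)
    where
    ι : Carrier
    ι = inverse (c a) ca≢0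

    d : Fin n → Carrier
    d i = ι * (single a (c a) i + - c i)

    d-supp : SupportedOn (S - a) d
    d-supp i i∉S-a = case i ≟ a of λ where
      (yes refl) → begin
        ι * (single a (c a) a + - c a)  ≡⟨ cong (λ x → ι * (x + - c a)) (single-≡ a (c a)) ⟩
        ι * (c a + - c a)               ≡⟨ cong (ι *_) (-‿inverseʳ (c a)) ⟩
        ι * 0#                          ≡⟨ zeroʳ ι ⟩
        0#                              ∎
      (no i≢a) → begin
        ι * (single a (c a) i + - c i)  ≡⟨ cong₂ (λ x y → ι * (x + - y)) (single-≢ (c a) i≢a)
                                                 (supp i (i∉S-a ∘ flip x∈p∧x≢y⇒x∈p-y i≢a)) ⟩
        ι * (0# + - 0#)                 ≡⟨ cong (ι *_) (-‿inverseʳ 0#) ⟩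
        ι * 0#                          ≡⟨ zeroʳ ι ⟩
        0#                              ∎

    lincomb-d : ∀ k → lincomb d k ≡ v a k
    lincomb-d k = begin
      lincomb d k
        ≡⟨ lincomb-* ι _ k ⟩
      ι * lincomb (λ i → single a (c a) i + - c i) k
        ≡⟨ cong (ι *_) (lincomb-+ (single a (c a)) _ k) ⟩
      ι * (lincomb (single a (c a)) k + lincomb (λ i → - c i) k)
        ≡⟨ cong₂ (λ x y → ι * (x + y)) (lincomb-single a (c a) k) (lincomb-neg c k) ⟩
      ι * (c a * v a k + - lincomb c k)
        ≡⟨ cong (λ x → ι * (c a * v a k + - x)) (lc≡0 k) ⟩
      ι * (c a * v a k + - 0#)
        ≡⟨ cong (λ x → ι * (c a * v a k + x)) -0#≈0# ⟩
      ι * (c a * v a k + 0#)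
        ≡⟨ cong (ι *_) (+-identityʳ _) ⟩
      ι * (c a * v a k)
        ≡⟨ inverse-cancelˡ (c a) ca≢0 (v a k) ⟩
      v a k
        ∎

  ¬independent∪⇒span : ∀ {I e} → Independent I → ¬ Independent (I ∪ ⁅ e ⁆) → Span I (v e)
  ¬independent∪⇒span {I} {e} ind ¬ind with ¬independent⇒dependent ¬ind
  ... | c , supp , lc≡0 , i , ci≢0 with c e ≟ 0#
  ...   | no ce≢0  = span-mono I∪e-e⊆I (dependence⇒span supp lc≡0 ce≢0)
    where
    I∪e-e⊆I : (I ∪ ⁅ e ⁆) - e ⊆ I
    I∪e-e⊆I x∈ = [ id , (λ x∈⁅e⁆ → contradiction (x∈⁅y⁆⇒x≡y e x∈⁅e⁆) (x∈p-y⇒x≢y x∈)) ]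
                   (x∈p∪q⁻ I ⁅ e ⁆ (p─q⊆p _ ⁅ e ⁆ x∈))
  ...   | yes ce≡0 = contradiction ind (dependent⇒¬independent (c , supp′ , lc≡0 , i , ci≢0))
    where
    supp′ : SupportedOn I c
    supp′ j j∉I with j ≟ e
    ... | yes refl = ce≡0
    ... | no j≢e   = supp j (∉-∪ j∉I (x≢y⇒x∉⁅y⁆ j≢e))

  ¬span⇒independent∪ : ∀ {I e} → Independent I → ¬ Span I (v e) → Independent (I ∪ ⁅ e ⁆)
  ¬span⇒independent∪ ind ¬span = decidable-stable (independent? _) (¬span ∘ ¬independent∪⇒span ind)

  span⇒¬independent∪ : ∀ {I e} → e ∉ I → Span I (v e) → ¬ Independent (I ∪ ⁅ e ⁆)
  span⇒¬independent∪ {I} {e} e∉I (d , d-supp , e≗) =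
    dependent⇒¬independent (c , c-supp , lincomb-c , e , ce≢0)
    where
    c : Fin n → Carrier
    c i = d i + single e (- 1#) i

    c-supp : SupportedOn (I ∪ ⁅ e ⁆) c
    c-supp i i∉I∪e = trans (cong₂ _+_ (d-supp i (i∉I∪e ∘ p⊆p∪q ⁅ e ⁆))
                                      (single-≢ (- 1#) (i∉I∪e ∘ x∈p∪q⁺ ∘ inj₂ ∘ x≡y⇒x∈⁅y⁆)))
                           (+-identityʳ 0#)

    lincomb-c : ∀ k → lincomb c k ≡ 0#
    lincomb-c k = begin
      lincomb c k                                    ≡⟨ lincomb-+ d _ k ⟩
      lincomb d k + lincomb (single e (- 1#)) k      ≡⟨ cong₂ _+_ (sym (e≗ k)) (lincomb-single e (- 1#) k) ⟩
      v e k + - 1# * v e k                           ≡⟨ cong (v e k +_) (-1*x≈-x (v e k)) ⟩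
      v e k + - v e k                                ≡⟨ -‿inverseʳ (v e k) ⟩
      0#                                             ∎

    ce≢0 : c e ≢ 0#
    ce≢0 ce≡0 = 1≢0 (-‿injective (begin
      - 1#                  ≡⟨ +-identityˡ _ ⟨
      0# + - 1#             ≡⟨ cong₂ _+_ (d-supp e e∉I) (single-≡ e (- 1#)) ⟨
      d e + single e (- 1#) e ≡⟨ ce≡0 ⟩
      0#                    ≡⟨ -0#≈0# ⟨
      - 0#                  ∎))

  greedy-basis : ∀ S xs → ∃[ I ] (I ⊆ S × Independent I × (∀ {i} → i ∈ₗ xs → i ∈ S → Span I (v i)))
  greedy-basis S [] = ⊥ , (λ i∈⊥ → contradiction i∈⊥ ∉⊥) , independent-⊥ , λ ()
  greedy-basis S (x ∷ xs) with greedy-basis S xs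
  ... | I , I⊆S , ind , spans with x ∈? S | span? I (v x)
  ... | no x∉S | _ = I , I⊆S , ind , λ where
    (here refl) x∈S → contradiction x∈S x∉S
    (there i∈xs)    → spans i∈xs
  ... | yes _ | yes x∈spanI = I , I⊆S , ind , λ where
    (here refl) _ → x∈spanI
    (there i∈xs)  → spans i∈xs
  ... | yes x∈S | no x∉spanI =
    I ∪ ⁅ x ⁆ , ∪-⊆ I⊆S (⁅⁆-⊆ x∈S) , ¬span⇒independent∪ ind x∉spanI , λ where
    (here refl) _    → span-∈ (x∈p∪q⁺ (inj₂ (x∈⁅x⁆ x)))
    (there i∈xs) i∈S → span-mono (p⊆p∪q ⁅ x ⁆) (spans i∈xs i∈S)

  basis : ∀ S → ∃[ I ] (I ⊆ S × Independent I × (∀ {i} → i ∈ S → Span I (v i)))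
  basis S = let I , I⊆S , ind , spans = greedy-basis S (allFin n) in I , I⊆S , ind , spans (∈-allFin _)

  span-⊥⁻ : ∀ {w} → Span ⊥ w → ∀ k → w k ≡ 0#
  span-⊥⁻ (c , supp , w≗) k = trans (w≗ k) (sum-zero (λ i → trans (cong (_* v i k) (supp i ∉⊥)) (zeroˡ _)))

  inClosure⇒span : ∀ {S e} → InCl Independent S e → Span S (v e)
  inClosure⇒span (inj₁ e∈S)                  = span-∈ e∈S
  inClosure⇒span (inj₂ (I , I⊆S , ind , ¬ind)) = span-mono I⊆S (¬independent∪⇒span ind ¬ind)

  span⇒inClosure : ∀ {S e} → Span S (v e) → InCl Independent S e
  span⇒inClosure {S} {e} span with basis S
  ... | I , I⊆S , ind , spans with e ∈? I
  ...   | yes e∈I = inj₁ (I⊆S e∈I)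
  ...   | no e∉I  = inj₂ (I , I⊆S , ind , span⇒¬independent∪ e∉I (span-trans spans span))

  Flat : Subset n → Set
  Flat = IsFlatP Independent

  flat⇒span-closed : ∀ {F e} → Flat F → Span F (v e) → e ∈ F
  flat⇒span-closed flat span = flat _ (span⇒inClosure span)

  span-closed⇒flat : ∀ {F} → (∀ {e} → Span F (v e) → e ∈ F) → Flat F
  span-closed⇒flat closed e = closed ∘ inClosure⇒span

  flat-⊤ : Flat ⊤
  flat-⊤ _ _ = ∈⊤

  flat-∩ : ∀ {A B} → Flat A → Flat B → Flat (A ∩ B)
  flat-∩ {A} {B} flatA flatB = span-closed⇒flat λ span →
    x∈p∩q⁺ (flat⇒span-closed flatA (span-mono (p∩q⊆p A B) span) ,
            flat⇒span-closed flatB (span-mono (p∩q⊆q A B) span))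

  flat-⊥ : (∀ i → ∃[ k ] v i k ≢ 0#) → Flat ⊥
  flat-⊥ nonzero = span-closed⇒flat λ {e} span →
    let k , vek≢0 = nonzero e in contradiction (span-⊥⁻ span k) vek≢0

  span-⁅⁆⁻ : ∀ {a w} → Span ⁅ a ⁆ w → ∃[ α ] (∀ k → w k ≡ α * v a k)
  span-⁅⁆⁻ {a} (c , supp , w≗) = c a , λ k → trans (w≗ k)
    (sum-single (λ i → c i * v i k) a (λ i i≢a → trans (cong (_* v i k) (supp i (x≢y⇒x∉⁅y⁆ i≢a))) (zeroˡ _)))

  span-pair⁺ : ∀ {a b w} α β → (∀ k → w k ≡ α * v a k + β * v b k) → Span (⁅ a ⁆ ∪ ⁅ b ⁆) w
  span-pair⁺ {a} {b} α β w≗ =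
    (λ i → single a α i + single b β i) ,
    (λ i i∉ → trans (cong₂ _+_ (single-≢ α (i∉ ∘ p⊆p∪q ⁅ b ⁆ ∘ x≡y⇒x∈⁅y⁆))
                              (single-≢ β (i∉ ∘ q⊆p∪q ⁅ a ⁆ ⁅ b ⁆ ∘ x≡y⇒x∈⁅y⁆)))
                    (+-identityʳ 0#)) ,
    λ k → trans (w≗ k) (sym (trans (lincomb-+ (single a α) (single b β) k)
                                   (cong₂ _+_ (lincomb-single a α k) (lincomb-single b β k))))

  span-pair⁻ : ∀ {a b w} → a ≢ b → Span (⁅ a ⁆ ∪ ⁅ b ⁆) w →
               ∃[ α ] ∃[ β ] (∀ k → w k ≡ α * v a k + β * v b k)
  span-pair⁻ {a} {b} a≢b (c , supp , w≗) = c a , c b , λ k → begin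
    _                                                       ≡⟨ w≗ k ⟩
    lincomb c k                                             ≡⟨ lincomb-cong c≗ k ⟩
    lincomb (λ i → single a (c a) i + single b (c b) i) k   ≡⟨ lincomb-+ (single a (c a)) (single b (c b)) k ⟩
    _                                                       ≡⟨ cong₂ _+_ (lincomb-single a (c a) k)
                                                                         (lincomb-single b (c b) k) ⟩
    c a * v a k + c b * v b k                               ∎
    where
    c≗ : ∀ i → c i ≡ single a (c a) i + single b (c b) i
    c≗ i = case i ≟ a of λ where
      (yes refl) → sym (trans (cong₂ _+_ (single-≡ a (c a)) (single-≢ (c b) a≢b)) (+-identityʳ _))
      (no i≢a)   → case i ≟ b of λ where
        (yes refl) → sym (trans (cong₂ _+_ (single-≢ (c a) i≢a) (single-≡ b (c b))) (+-identityˡ _))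
        (no i≢b)   → trans (supp i (∉-∪ (x≢y⇒x∉⁅y⁆ i≢a) (x≢y⇒x∉⁅y⁆ i≢b)))
                           (sym (trans (cong₂ _+_ (single-≢ (c a) i≢a) (single-≢ (c b) i≢b)) (+-identityʳ 0#)))

  independent-∪⇔¬span : ∀ {A e} → e ∉ A → (∃[ k ] v e k ≢ 0#) →
                         Independent (A ∪ ⁅ e ⁆) ⇔ (∀ {a} → a ∈ A → ¬ Span ((A - a) ∪ ⁅ e ⁆) (v a))
  independent-∪⇔¬span {A} {e} e∉A (k , vek≢0) = mk⇔ to from
    where
    to : Independent (A ∪ ⁅ e ⁆) → ∀ {a} → a ∈ A → ¬ Span ((A - a) ∪ ⁅ e ⁆) (v a)
    to ind {a} a∈A span = span⇒¬independent∪ a∉ span (independent-mono sub ind)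
      where
      a∉ : a ∉ (A - a) ∪ ⁅ e ⁆
      a∉ = ∉-∪ (λ a∈A-a → x∈p-y⇒x≢y a∈A-a refl)
               (λ a∈⁅e⁆ → e∉A (subst (_∈ A) (x∈⁅y⁆⇒x≡y e a∈⁅e⁆) a∈A))
      sub : ((A - a) ∪ ⁅ e ⁆) ∪ ⁅ a ⁆ ⊆ A ∪ ⁅ e ⁆
      sub = ∪-⊆ (∪-⊆ (p⊆p∪q ⁅ e ⁆ ∘ p─q⊆p A ⁅ a ⁆) (q⊆p∪q A ⁅ e ⁆)) (⁅⁆-⊆ (p⊆p∪q ⁅ e ⁆ a∈A))

    from : (∀ {a} → a ∈ A → ¬ Span ((A - a) ∪ ⁅ e ⁆) (v a)) → Independent (A ∪ ⁅ e ⁆)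
    from ¬span = ¬dependent⇒independent λ (c , supp , lc≡0 , i , ci≢0) →
      case any? (λ a → (a ∈? A) ×-dec ¬? (c a ≟ 0#)) of λ where
        (yes (a , a∈A , ca≢0)) → ¬span a∈A (span-mono (sub a) (dependence⇒span supp lc≡0 ca≢0))
        (no ∄a) → ci≢0 (vanishing-on-A⇒zero c supp lc≡0
                          (λ a a∈A → decidable-stable (c a ≟ 0#) (∄a ∘ (a ,_) ∘ (a∈A ,_))) i)
      where
      sub : ∀ a → (A ∪ ⁅ e ⁆) - a ⊆ (A - a) ∪ ⁅ e ⁆
      sub a x∈ = [ p⊆p∪q ⁅ e ⁆ ∘ flip x∈p∧x≢y⇒x∈p-y (x∈p-y⇒x≢y x∈) , q⊆p∪q (A - a) ⁅ e ⁆ ]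
                   (x∈p∪q⁻ A ⁅ e ⁆ (p─q⊆p _ ⁅ a ⁆ x∈))
      vanishing-on-A⇒zero : ∀ c → SupportedOn (A ∪ ⁅ e ⁆) c → (∀ k → lincomb c k ≡ 0#) →
                            (∀ a → a ∈ A → c a ≡ 0#) → ∀ i → c i ≡ 0#
      vanishing-on-A⇒zero c supp lc≡0 cA≡0 i with i ≟ e | i ∈? A
      ... | _        | yes i∈A = cA≡0 i i∈A
      ... | no i≢e   | no i∉A  = supp i (∉-∪ i∉A (x≢y⇒x∉⁅y⁆ i≢e))
      ... | yes refl | no i∉A  = x≢0∧x*y≡0⇒y≡0 vek≢0 (begin
        v e k * c e  ≡⟨ *-comm _ _ ⟩
        c e * v e k  ≡⟨ proj₂ (span-⁅⁆⁻ (c , supp′ , λ _ → refl)) k ⟨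
        lincomb c k  ≡⟨ lc≡0 k ⟩
        0#           ∎)
        where
        supp′ : SupportedOn ⁅ e ⁆ c
        supp′ j j∉⁅e⁆ with j ∈? A
        ... | yes j∈A = cA≡0 j j∈A
        ... | no j∉A  = supp j (∉-∪ j∉A j∉⁅e⁆)

-- Chains of flats

chain-mono : ∀ {n k} {G : ℕ → Subset n} → (∀ i → i < k → G i ⊆ G (suc i)) →
             ∀ {i j} → i ≤ j → j ≤ k → G i ⊆ G j
chain-mono chain {j = zero}  z≤n   _ = id
chain-mono chain {i} {suc j} i≤1+j 1+j≤k with m≤n⇒m<n∨m≡n i≤1+j
... | inj₁ i<1+j = chain j 1+j≤k ∘ chain-mono chain (≤-pred i<1+j) (<⇒≤ 1+j≤k)
... | inj₂ refl  = id

module Layering {q : ℕ} (𝔽 : FiniteField q) {n r : ℕ} (v : Fin n → Fin r → Fin q) where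
  open Nat using (_+_; _*_)
  open LinearAlgebra 𝔽 v using (Flat; flat-⊤; flat-∩)

  InEvenLayer : ℕ → (ℕ → Subset n) → Fin n → Set
  InEvenLayer k G e = ∃[ i ] (i < k × (∃[ j ] i ≡ 2 * j) × e ∈ G (suc i) × e ∉ G i)

  IsLayering : Subset n → ℕ → (ℕ → Subset n) → Set
  IsLayering X k G = (∀ e → e ∉ G 0)
                   × (∀ i → i < k → G i ⊆ G (suc i))
                   × (∀ i → i ≤ k → Flat (G i))
                   × (∀ e → e ∈ X ⇔ InEvenLayer k G e)

  Layered : Subset n → Set
  Layered X = ∃[ k ] Σ (ℕ → Subset n) (IsLayering X k)

  targetSet⇒layered : ∀ {X} → IsTargetSet 𝔽 v X → Layered X
  targetSet⇒layered (k , F , empty , _ , chain , flats , layers) = k , F , empty , chain , flats , layers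

  module Padding {X : Subset n} (k : ℕ) (G : ℕ → Subset n)
                 (empty : ∀ e → e ∉ G 0) (chain : ∀ i → i < k → G i ⊆ G (suc i))
                 (flats : ∀ i → i ≤ k → Flat (G i)) (layers : ∀ e → e ∈ X ⇔ InEvenLayer k G e) where

    top : ℕ
    top = suc (2 * k)

    k≤top : k ≤ top
    k≤top = m≤n⇒m≤1+n (m≤m+n k (k + 0))

    -- G up to index k, constantly G k up to index 2k+1, then ⊤: the one new layer is odd.
    padded : ℕ → Subset n
    padded i with i ≤? top
    ... | yes _ = G (i ⊓ k)
    ... | no _  = ⊤

    padded-≤ : ∀ {i} → i ≤ top → padded i ≡ G (i ⊓ k)
    padded-≤ {i} i≤top with i ≤? top
    ... | yes _    = refl
    ... | no i≰top = contradiction i≤top i≰top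

    padded-top : padded (suc top) ≡ ⊤
    padded-top with suc top ≤? top
    ... | yes 1+top≤top = contradiction 1+top≤top (1+n≰n {top})
    ... | no _          = refl

    padded-below : ∀ {i} → i ≤ k → padded i ≡ G i
    padded-below {i} i≤k = trans (padded-≤ (≤-trans i≤k k≤top)) (cong G (m≤n⇒m⊓n≡m i≤k))

    padded-above : ∀ {i} → k ≤ i → i ≤ top → padded i ≡ G k
    padded-above k≤i i≤top = trans (padded-≤ i≤top) (cong G (m≥n⇒m⊓n≡n k≤i))

    padded-chain : ∀ i → i < suc top → padded i ⊆ padded (suc i)
    padded-chain i i<1+top with m≤n⇒m<n∨m≡n (≤-pred i<1+top)
    ... | inj₁ i<top = subst₂ _⊆_ (sym (padded-≤ (<⇒≤ i<top))) (sym (padded-≤ i<top))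
                         (chain-mono chain (⊓-monoˡ-≤ k (n≤1+n i)) (m⊓n≤n (suc i) k))
    ... | inj₂ refl  = subst (padded top ⊆_) (sym padded-top) ⊆⊤

    padded-flat : ∀ i → Flat (padded i)
    padded-flat i with i ≤? top
    ... | yes _ = flats (i ⊓ k) (m⊓n≤n i k)
    ... | no _  = flat-⊤

    padded-layers : ∀ e → e ∈ X ⇔ InEvenLayer (suc top) padded e
    padded-layers e = mk⇔ to from
      where
      to : e ∈ X → InEvenLayer (suc top) padded e
      to e∈X with Equivalence.to (layers e) e∈X
      ... | i , i<k , even , e∈ , e∉ =
        i , s≤s (≤-trans (<⇒≤ i<k) k≤top) , even ,
        subst (e ∈_) (sym (padded-below i<k)) e∈ , subst (e ∉_) (sym (padded-below (<⇒≤ i<k))) e∉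

      from : InEvenLayer (suc top) padded e → e ∈ X
      from (i , i<1+top , (j , i≡2j) , e∈ , e∉) with i <? k
      ... | yes i<k = Equivalence.from (layers e)
        (i , i<k , (j , i≡2j) , subst (e ∈_) (padded-below i<k) e∈ , subst (e ∉_) (padded-below (<⇒≤ i<k)) e∉)
      ... | no i≮k with m≤n⇒m<n∨m≡n (≤-pred i<1+top)
      ...   | inj₁ i<top = contradiction (subst (e ∈_) padded[1+i]≡padded[i] e∈) e∉
        where
        padded[1+i]≡padded[i] : padded (suc i) ≡ padded i
        padded[1+i]≡padded[i] = trans (padded-above (m≤n⇒m≤1+n (≮⇒≥ i≮k)) i<top)
                                      (sym (padded-above (≮⇒≥ i≮k) (<⇒≤ i<top)))
      ...   | inj₂ refl  = contradiction (sym i≡2j) (even≢odd j k)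

  layered⇒targetSet : ∀ {X} → Layered X → IsTargetSet 𝔽 v X
  layered⇒targetSet (k , G , empty , chain , flats , layers) =
    suc top , padded , subst (λ G0 → ∀ e → e ∉ G0) (sym (padded-≤ z≤n)) empty ,
    (λ e → subst (e ∈_) (sym padded-top) ∈⊤) , padded-chain , (λ i _ → padded-flat i) , padded-layers
    where open Padding k G empty chain flats layers

  layered-∩-flat : ∀ {X W} → Layered X → Flat W → Layered (X ∩ W)
  layered-∩-flat {X} {W} (k , G , empty , chain , flats , layers) flatW =
    k , (λ i → G i ∩ W) , (λ e → empty e ∘ p∩q⊆p _ W) ,
    (λ i i<k → ⊆-∩ (chain i i<k ∘ p∩q⊆p _ W) (p∩q⊆q _ W)) ,
    (λ i i≤k → flat-∩ (flats i i≤k) flatW) , layers∩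
    where
    layers∩ : ∀ e → e ∈ X ∩ W ⇔ InEvenLayer k (λ i → G i ∩ W) e
    layers∩ e = mk⇔ to from
      where
      to : e ∈ X ∩ W → InEvenLayer k (λ i → G i ∩ W) e
      to e∈X∩W with Equivalence.to (layers e) (p∩q⊆p X W e∈X∩W)
      ... | i , i<k , even , e∈ , e∉ = i , i<k , even , x∈p∩q⁺ (e∈ , p∩q⊆q X W e∈X∩W) , e∉ ∘ p∩q⊆p _ W

      from : InEvenLayer k (λ i → G i ∩ W) e → e ∈ X ∩ W
      from (i , i<k , even , e∈ , e∉) = x∈p∩q⁺
        (Equivalence.from (layers e)
           (i , i<k , even , p∩q⊆p _ W e∈ , λ e∈G → e∉ (x∈p∩q⁺ (e∈G , p∩q⊆q _ W e∈))) ,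
         p∩q⊆q _ W e∈)

module _ {m n : ℕ} (φ : Fin m → Fin n) where

  image-∪ : ∀ A B → image φ (A ∪ B) ≡ image φ A ∪ image φ B
  image-∪ A B = ⊆-antisym to from
    where
    to : image φ (A ∪ B) ⊆ image φ A ∪ image φ B
    to y∈ with ∈-image⁻ φ y∈
    ... | x , x∈A∪B , refl =
      [ x∈p∪q⁺ ∘ inj₁ ∘ ∈-image⁺ φ , x∈p∪q⁺ ∘ inj₂ ∘ ∈-image⁺ φ ] (x∈p∪q⁻ A B x∈A∪B)
    from : image φ A ∪ image φ B ⊆ image φ (A ∪ B)
    from = ∪-⊆ (image-mono (p⊆p∪q B)) (image-mono (q⊆p∪q A B))
      where
      image-mono : ∀ {S T} → S ⊆ T → image φ S ⊆ image φ T
      image-mono S⊆T y∈ with ∈-image⁻ φ y∈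
      ... | x , x∈S , refl = ∈-image⁺ φ (S⊆T x∈S)

  image-⁅⁆ : ∀ a → image φ ⁅ a ⁆ ≡ ⁅ φ a ⁆
  image-⁅⁆ a = ⊆-antisym to (⁅⁆-⊆ (∈-image⁺ φ (x∈⁅x⁆ a)))
    where
    to : image φ ⁅ a ⁆ ⊆ ⁅ φ a ⁆
    to y∈ with ∈-image⁻ φ y∈
    ... | x , x∈⁅a⁆ , refl = x≡y⇒x∈⁅y⁆ (cong φ (x∈⁅y⁆⇒x≡y a x∈⁅a⁆))

  image-preimage : ∀ {Z I} → I ⊆ image φ Z → image φ (Z ∩ preimage φ I) ≡ I
  image-preimage {Z} {I} I⊆ = ⊆-antisym to from
    where
    to : image φ (Z ∩ preimage φ I) ⊆ I
    to y∈ with ∈-image⁻ φ y∈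
    ... | x , x∈ , refl = ∈-preimage⁻ φ {I} (p∩q⊆q Z _ x∈)
    from : I ⊆ image φ (Z ∩ preimage φ I)
    from y∈I with ∈-image⁻ φ (I⊆ y∈I)
    ... | x , x∈Z , refl = ∈-image⁺ φ (x∈p∩q⁺ (x∈Z , ∈-preimage⁺ φ {I} y∈I))

image-∘ : ∀ {k m n} (f : Fin k → Fin m) (g : Fin m → Fin n) T → image (g ∘ f) T ≡ image g (image f T)
image-∘ f g T = ⊆-antisym to from
  where
  to : image (g ∘ f) T ⊆ image g (image f T)
  to y∈ with ∈-image⁻ (g ∘ f) y∈
  ... | x , x∈T , refl = ∈-image⁺ g (∈-image⁺ f x∈T)
  from : image g (image f T) ⊆ image (g ∘ f) T
  from y∈ with ∈-image⁻ g y∈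
  ... | z , z∈ , refl with ∈-image⁻ f z∈
  ...   | x , x∈T , refl = ∈-image⁺ (g ∘ f) x∈T

module RestrictionIso {m n : ℕ} {IndN : IndepPred m} {IndM : IndepPred n} {X : Subset n}
                      (iso : IsoToRestriction IndN IndM X) where

  φ : Fin m → Fin n
  φ = proj₁ iso

  φ-injective : Injective _≡_ _≡_ φ
  φ-injective = proj₁ (proj₂ iso)

  ∈X⇔∈range : ∀ j → j ∈ X ⇔ (∃[ i ] φ i ≡ j)
  ∈X⇔∈range = proj₁ (proj₂ (proj₂ iso))

  independent⇔ : ∀ I → I ⊆ X → IndM I ⇔ IndN (preimage φ I)
  independent⇔ = proj₂ (proj₂ (proj₂ iso))

  φ-∈ : ∀ i → φ i ∈ X
  φ-∈ i = Equivalence.from (∈X⇔∈range (φ i)) (i , refl)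

  image⊆X : ∀ T → image φ T ⊆ X
  image⊆X T y∈ with ∈-image⁻ φ y∈
  ... | i , _ , refl = φ-∈ i

  preimage-image : ∀ T → preimage φ (image φ T) ≡ T
  preimage-image T = ⊆-antisym to (∈-preimage⁺ φ {image φ T} ∘ ∈-image⁺ φ)
    where
    to : preimage φ (image φ T) ⊆ T
    to i∈ with ∈-image⁻ φ (∈-preimage⁻ φ {image φ T} i∈)
    ... | j , j∈T , φj≡φi = subst (_∈ T) (φ-injective φj≡φi) j∈T

  independent-image : ∀ T → IndM (image φ T) ⇔ IndN T
  independent-image T = subst (λ S → IndM (image φ T) ⇔ IndN S) (preimage-image T)
                              (independent⇔ (image φ T) (image⊆X T))

  preimage-mono : ∀ {I J} → I ⊆ J → preimage φ I ⊆ preimage φ J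
  preimage-mono {I} {J} I⊆J = ∈-preimage⁺ φ {J} ∘ I⊆J ∘ ∈-preimage⁻ φ {I}

  preimage-⊆ : ∀ {I T} → I ⊆ image φ T → preimage φ I ⊆ T
  preimage-⊆ {I} {T} I⊆ = subst (preimage φ I ⊆_) (preimage-image T) (preimage-mono I⊆)

  preimage-∪-⁅⁆ : ∀ I a → preimage φ (I ∪ ⁅ φ a ⁆) ≡ preimage φ I ∪ ⁅ a ⁆
  preimage-∪-⁅⁆ I a = ⊆-antisym to from
    where
    to : preimage φ (I ∪ ⁅ φ a ⁆) ⊆ preimage φ I ∪ ⁅ a ⁆
    to i∈ = [ x∈p∪q⁺ ∘ inj₁ ∘ ∈-preimage⁺ φ {I}
            , x∈p∪q⁺ ∘ inj₂ ∘ x≡y⇒x∈⁅y⁆ ∘ φ-injective ∘ x∈⁅y⁆⇒x≡y (φ a) ]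
              (x∈p∪q⁻ I ⁅ φ a ⁆ (∈-preimage⁻ φ {I ∪ ⁅ φ a ⁆} i∈))
    from : preimage φ I ∪ ⁅ a ⁆ ⊆ preimage φ (I ∪ ⁅ φ a ⁆)
    from = ∪-⊆ (preimage-mono {I} (p⊆p∪q ⁅ φ a ⁆))
                (∈-preimage⁺ φ {I ∪ ⁅ φ a ⁆} ∘ q⊆p∪q I ⁅ φ a ⁆ ∘ x≡y⇒x∈⁅y⁆ ∘ cong φ ∘ x∈⁅y⁆⇒x≡y a)

  inClosure-preimage : ∀ {S a} → S ⊆ X → InCl IndM S (φ a) → InCl IndN (preimage φ S) a
  inClosure-preimage {S} S⊆X (inj₁ φa∈S) = inj₁ (∈-preimage⁺ φ {S} φa∈S)
  inClosure-preimage {S} {a} S⊆X (inj₂ (I , I⊆S , indI , ¬indIa)) =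
    inj₂ (preimage φ I , preimage-mono I⊆S , Equivalence.to (independent⇔ I I⊆X) indI ,
          ¬indIa ∘ Equivalence.from (independent⇔ (I ∪ ⁅ φ a ⁆) (∪-⊆ I⊆X (⁅⁆-⊆ (φ-∈ a))))
                 ∘ subst IndN (sym (preimage-∪-⁅⁆ I a)))
    where
    I⊆X : I ⊆ X
    I⊆X = S⊆X ∘ I⊆S

  compose : ∀ {k} {IndK : IndepPred k} {F} → IsoToRestriction IndK IndN F → IsoToRestriction IndK IndM (image φ F)
  compose {IndK = IndK} {F} (ψ , ψ-injective , ∈F⇔∈range , independentF⇔) =
    φ ∘ ψ , ψ-injective ∘ φ-injective , range , independent
    where
    range : ∀ j → j ∈ image φ F ⇔ (∃[ i ] φ (ψ i) ≡ j)
    range j = mk⇔ to λ (i , φψi≡j) →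
      subst (_∈ image φ F) φψi≡j (∈-image⁺ φ (Equivalence.from (∈F⇔∈range (ψ i)) (i , refl)))
      where
      to : j ∈ image φ F → ∃[ i ] φ (ψ i) ≡ j
      to j∈ with ∈-image⁻ φ j∈
      ... | a , a∈F , refl with Equivalence.to (∈F⇔∈range a) a∈F
      ...   | i , refl = i , refl

    independent : ∀ I → I ⊆ image φ F → IndM I ⇔ IndK (preimage (φ ∘ ψ) I)
    independent I I⊆ = subst (λ S → IndM I ⇔ IndK S) (preimage-∘ ψ φ I)
      (⇔-trans (independent⇔ I (image⊆X F ∘ I⊆)) (independentF⇔ (preimage φ I) (preimage-⊆ I⊆)))

-- Induced restrictions

module _ {q : ℕ} (𝔽 : FiniteField q) where

  induced-restriction-target : ∀ {k m} {L : Matroid m} {N : Matroid k} →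
                               IsTarget 𝔽 L → IsInducedRestriction N L → IsTarget 𝔽 N
  induced-restriction-target {L = L} {N} (r , n , v , pg , X , targetX , ψiso) (F , flatF , φiso) =
    r , n , v , pg , image ψ F , targetY , compose {IndK = Indep N} φiso
    where
    open LinearAlgebra 𝔽 v
    open Layering 𝔽 v
    open RestrictionIso {IndN = Indep L} {IndM = Independent} ψiso renaming (φ to ψ)

    inSpan? : Decidable (λ p → Span (image ψ F) (v p))
    inSpan? p = span? (image ψ F) (v p)

    W : Subset n
    W = subsetOf inSpan?

    W-flat : Flat W
    W-flat = span-closed⇒flat λ span → ∈-subsetOf⁺ inSpan? (span-trans (∈-subsetOf⁻ inSpan?) span)

    X∩W⊆ψF : X ∩ W ⊆ image ψ F
    X∩W⊆ψF {p} p∈X∩W with Equivalence.to (∈X⇔∈range p) (p∩q⊆p X W p∈X∩W)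
    ... | a , refl = ∈-image⁺ ψ (flatF a (subst (λ S → InCl (Indep L) S a) (preimage-image F) inCl))
      where
      inCl : InCl (Indep L) (preimage ψ (image ψ F)) a
      inCl = inClosure-preimage (image⊆X F) (span⇒inClosure (∈-subsetOf⁻ inSpan? (p∩q⊆q X W p∈X∩W)))

    targetY : IsTargetSet 𝔽 v (image ψ F)
    targetY = subst (IsTargetSet 𝔽 v)
      (⊆-antisym X∩W⊆ψF (⊆-∩ (image⊆X F) (∈-subsetOf⁺ inSpan? ∘ span-∈)))
      (layered⇒targetSet (layered-∩-flat (targetSet⇒layered targetX) W-flat))

-- Projection of PG(r-1,q) from a point, and simplified contractions

module ProjectiveGeometry {q : ℕ} (𝔽 : FiniteField q) {n r : ℕ} (v : Fin n → Fin r → Fin q)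
                          (pg : IsPG 𝔽 r v) where
  open FieldProperties 𝔽
  open LinearAlgebra 𝔽 v
  open ≡-Reasoning

  nonzero : ∀ i → ∃[ k ] v i k ≢ 0#
  nonzero = proj₁ pg

  parallel⇒≡ : ∀ {i j} c → (∀ k → v j k ≡ c * v i k) → i ≡ j
  parallel⇒≡ c = proj₁ (proj₂ pg) _ _ c

  represented : ∀ w → (∃[ k ] w k ≢ 0#) → ∃[ i ] ∃[ c ] (∀ k → w k ≡ c * v i k)
  represented = proj₂ (proj₂ pg)

  independent-⁅⁆ : ∀ a → Independent ⁅ a ⁆
  independent-⁅⁆ a = independent-mono (q⊆p∪q ⊥ ⁅ a ⁆) (¬span⇒independent∪ independent-⊥ ¬span)
    where
    ¬span : ¬ Span ⊥ (v a)
    ¬span span = proj₂ (nonzero a) (span-⊥⁻ span (proj₁ (nonzero a)))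

  independent-pair : ∀ {a b} → a ≢ b → Independent (⁅ a ⁆ ∪ ⁅ b ⁆)
  independent-pair {a} a≢b = ¬span⇒independent∪ (independent-⁅⁆ a) λ span →
    a≢b (parallel⇒≡ (proj₁ (span-⁅⁆⁻ span)) (proj₂ (span-⁅⁆⁻ span)))

  +-parallel⇒≡ : ∀ {a b} c → (∀ k → v a k + v b k ≡ c * v b k) → b ≡ a
  +-parallel⇒≡ {a} {b} c vab≗ = parallel⇒≡ (c + - 1#) λ k → begin
    v a k                          ≡⟨ +-identityʳ _ ⟨
    v a k + 0#                     ≡⟨ cong (v a k +_) (-‿inverseʳ (v b k)) ⟨
    v a k + (v b k + - v b k)      ≡⟨ +-assoc _ _ _ ⟨
    (v a k + v b k) + - v b k      ≡⟨ cong₂ (λ x y → x + - y) (sym (vab≗ k)) (*-identityˡ (v b k)) ⟨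
    c * v b k + - (1# * v b k)     ≡⟨ cong (c * v b k +_) (-‿distribˡ-* 1# (v b k)) ⟩
    c * v b k + (- 1#) * v b k     ≡⟨ distribʳ (v b k) c (- 1#) ⟨
    (c + - 1#) * v b k             ∎

  pair-⊆ : ∀ {a b : Fin n} {S} → a ∈ S → b ∈ S → ⁅ a ⁆ ∪ ⁅ b ⁆ ⊆ S
  pair-⊆ a∈S b∈S = ∪-⊆ (⁅⁆-⊆ a∈S) (⁅⁆-⊆ b∈S)

  module Projection (e : Fin n) where

    k₀ : Fin r
    k₀ = proj₁ (nonzero e)

    vek₀≢0 : v e k₀ ≢ 0#
    vek₀≢0 = proj₂ (nonzero e)

    inH? : ∀ p → Dec (v p k₀ ≡ 0#)
    inH? p = v p k₀ ≟ 0#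

    H : Subset n
    H = subsetOf inH?

    e∉H : e ∉ H
    e∉H = vek₀≢0 ∘ ∈-subsetOf⁻ inH?

    -- v p = residual p + height p · v e with residual p in H; π p is the point of residual p.
    height : Fin n → Carrier
    height p = v p k₀ * inverse (v e k₀) vek₀≢0

    residual : Fin n → Fin r → Carrier
    residual p k = v p k + - (height p * v e k)

    height-k₀ : ∀ p → height p * v e k₀ ≡ v p k₀
    height-k₀ p = begin
      (v p k₀ * inverse (v e k₀) vek₀≢0) * v e k₀  ≡⟨ *-assoc _ _ _ ⟩
      v p k₀ * (inverse (v e k₀) vek₀≢0 * v e k₀)  ≡⟨ cong (v p k₀ *_) (inverse-inverseˡ _ vek₀≢0) ⟩
      v p k₀ * 1#                                   ≡⟨ *-identityʳ _ ⟩
      v p k₀                                        ∎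

    residual-k₀ : ∀ p → residual p k₀ ≡ 0#
    residual-k₀ p = trans (cong (λ x → v p k₀ + - x) (height-k₀ p)) (-‿inverseʳ _)

    residual-nonzero : ∀ {p} → p ≢ e → ∃[ k ] residual p k ≢ 0#
    residual-nonzero {p} p≢e = ¬∀⟶∃¬ r _ (λ k → residual p k ≟ 0#) λ residual≡0 →
      p≢e (sym (parallel⇒≡ (height p) (λ k → x∙y⁻¹≈ε⇒x≈y _ _ (residual≡0 k))))

    decomposition : ∀ p k → v p k ≡ residual p k + height p * v e k
    decomposition p k = sym (begin
      (v p k + - hv) + hv  ≡⟨ +-assoc _ _ _ ⟩
      v p k + (- hv + hv)  ≡⟨ cong (v p k +_) (-‿inverseˡ hv) ⟩
      v p k + 0#           ≡⟨ +-identityʳ _ ⟩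
      v p k                ∎)
      where hv = height p * v e k

    projection : ∀ p → Dec (p ≡ e) → ∃[ h ] ∃[ c ] (p ≢ e → ∀ k → residual p k ≡ c * v h k)
    projection p (yes p≡e) = e , 0# , λ p≢e → contradiction p≡e p≢e
    projection p (no p≢e) with represented (residual p) (residual-nonzero p≢e)
    ... | h , c , residual≗ = h , c , λ _ → residual≗

    π : Fin n → Fin n
    π p = proj₁ (projection p (p ≟ e))

    scale : Fin n → Carrier
    scale p = proj₁ (proj₂ (projection p (p ≟ e)))

    residual-π : ∀ {p} → p ≢ e → ∀ k → residual p k ≡ scale p * v (π p) k
    residual-π {p} = proj₂ (proj₂ (projection p (p ≟ e)))

    scale≢0 : ∀ {p} → p ≢ e → scale p ≢ 0#
    scale≢0 {p} p≢e scale≡0 = let k , residual≢0 = residual-nonzero p≢e in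
      residual≢0 (trans (residual-π p≢e k) (trans (cong (_* v (π p) k) scale≡0) (zeroˡ _)))

    π-decomposition : ∀ {p} → p ≢ e → ∀ k → v p k ≡ scale p * v (π p) k + height p * v e k
    π-decomposition {p} p≢e k = trans (decomposition p k) (cong (_+ height p * v e k) (residual-π p≢e k))

    π-∈H : ∀ {p} → p ≢ e → π p ∈ H
    π-∈H p≢e = ∈-subsetOf⁺ inH?
      (x≢0∧x*y≡0⇒y≡0 (scale≢0 p≢e) (trans (sym (residual-π p≢e k₀)) (residual-k₀ _)))

    π-unique : ∀ {x h a b} → x ≢ e → h ∈ H → a ≢ 0# → (∀ k → v x k ≡ a * v h k + b * v e k) → π x ≡ h
    π-unique {x} {h} {a} {b} x≢e h∈H a≢0 vx≗ = parallel⇒≡ (inverse a a≢0 * scale x) λ k → begin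
      v h k                                       ≡⟨ inverse-cancelˡ a a≢0 (v h k) ⟨
      inverse a a≢0 * (a * v h k)                 ≡⟨ cong (inverse a a≢0 *_) (residual-x k) ⟨
      inverse a a≢0 * residual x k                ≡⟨ cong (inverse a a≢0 *_) (residual-π x≢e k) ⟩
      inverse a a≢0 * (scale x * v (π x) k)       ≡⟨ *-assoc _ _ _ ⟨
      (inverse a a≢0 * scale x) * v (π x) k       ∎
      where
      height-x : height x ≡ b
      height-x = begin
        v x k₀ * ι                            ≡⟨ cong (_* ι) (vx≗ k₀) ⟩
        (a * v h k₀ + b * v e k₀) * ι         ≡⟨ cong (λ y → (a * y + b * v e k₀) * ι) (∈-subsetOf⁻ inH? h∈H) ⟩
        (a * 0# + b * v e k₀) * ι             ≡⟨ cong (λ y → (y + b * v e k₀) * ι) (zeroʳ a) ⟩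
        (0# + b * v e k₀) * ι                 ≡⟨ cong (_* ι) (+-identityˡ _) ⟩
        (b * v e k₀) * ι                      ≡⟨ *-assoc _ _ _ ⟩
        b * (v e k₀ * ι)                      ≡⟨ cong (b *_) (*-comm _ ι) ⟩
        b * (ι * v e k₀)                      ≡⟨ cong (b *_) (inverse-inverseˡ _ vek₀≢0) ⟩
        b * 1#                                ≡⟨ *-identityʳ b ⟩
        b                                     ∎
        where ι = inverse (v e k₀) vek₀≢0
      residual-x : ∀ k → residual x k ≡ a * v h k
      residual-x k = begin
        v x k + - (height x * v e k)               ≡⟨ cong₂ (λ y z → y + - (z * v e k)) (vx≗ k) height-x ⟩
        (a * v h k + b * v e k) + - (b * v e k)    ≡⟨ +-assoc _ _ _ ⟩
        a * v h k + (b * v e k + - (b * v e k))    ≡⟨ cong (a * v h k +_) (-‿inverseʳ _) ⟩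
        a * v h k + 0#                             ≡⟨ +-identityʳ _ ⟩
        a * v h k                                  ∎

    ∈H⇒≢e : ∀ {h} → h ∈ H → h ≢ e
    ∈H⇒≢e h∈H refl = e∉H h∈H

    π-fixes-H : ∀ {h} → h ∈ H → π h ≡ h
    π-fixes-H {h} h∈H = π-unique (∈H⇒≢e h∈H) h∈H 1≢0 λ k → sym (begin
      1# * v h k + 0# * v e k  ≡⟨ cong₂ _+_ (*-identityˡ _) (zeroˡ _) ⟩
      v h k + 0#               ≡⟨ +-identityʳ _ ⟩
      v h k                    ∎)

    -- The witness is the point of v h + v e.
    π-fibre : ∀ {h} → h ∈ H → ∃[ x ] (x ≢ e × x ≢ h × π x ≡ h)
    π-fibre {h} h∈H with represented (λ k → v h k + v e k) (k₀ , vek₀≢0 ∘ trans (sym w-k₀))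
      where
      w-k₀ : v h k₀ + v e k₀ ≡ v e k₀
      w-k₀ = trans (cong (_+ v e k₀) (∈-subsetOf⁻ inH? h∈H)) (+-identityˡ _)
    ... | x , c , w≗ = x , x≢e , x≢h , π-unique x≢e h∈H (inverse-≢0 c c≢0) vx≗
      where
      c≢0 : c ≢ 0#
      c≢0 c≡0 = vek₀≢0 (begin
        v e k₀                  ≡⟨ +-identityˡ _ ⟨
        0# + v e k₀             ≡⟨ cong (_+ v e k₀) (∈-subsetOf⁻ inH? h∈H) ⟨
        v h k₀ + v e k₀         ≡⟨ w≗ k₀ ⟩
        c * v x k₀              ≡⟨ cong (_* v x k₀) c≡0 ⟩
        0# * v x k₀             ≡⟨ zeroˡ _ ⟩
        0#                      ∎)
      x≢e : x ≢ e
      x≢e refl = ∈H⇒≢e h∈H (sym (+-parallel⇒≡ c w≗))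
      x≢h : x ≢ h
      x≢h refl = ∈H⇒≢e h∈H (+-parallel⇒≡ c (λ k → trans (+-comm _ _) (w≗ k)))
      vx≗ : ∀ k → v x k ≡ inverse c c≢0 * v h k + inverse c c≢0 * v e k
      vx≗ k = begin
        v x k                                          ≡⟨ inverse-cancelˡ c c≢0 (v x k) ⟨
        inverse c c≢0 * (c * v x k)                    ≡⟨ cong (inverse c c≢0 *_) (w≗ k) ⟨
        inverse c c≢0 * (v h k + v e k)                ≡⟨ distribˡ _ _ _ ⟩
        inverse c c≢0 * v h k + inverse c c≢0 * v e k  ∎

    span-π : ∀ {x} → x ≢ e → Span (⁅ π x ⁆ ∪ ⁅ e ⁆) (v x)
    span-π x≢e = span-pair⁺ _ _ (π-decomposition x≢e)

    span-π⁻¹ : ∀ {x} → x ≢ e → Span (⁅ x ⁆ ∪ ⁅ e ⁆) (v (π x))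
    span-π⁻¹ {x} x≢e = span-pair⁺ ι (- (ι * height x)) λ k → begin
      v (π x) k                                      ≡⟨ inverse-cancelˡ (scale x) (scale≢0 x≢e) _ ⟨
      ι * (scale x * v (π x) k)                      ≡⟨ cong (ι *_) (residual-π x≢e k) ⟨
      ι * (v x k + - (height x * v e k))             ≡⟨ distribˡ ι _ _ ⟩
      ι * v x k + ι * - (height x * v e k)           ≡⟨ cong (ι * v x k +_) (-‿distribʳ-* ι _) ⟨
      ι * v x k + - (ι * (height x * v e k))         ≡⟨ cong (λ y → ι * v x k + - y) (*-assoc ι _ _) ⟨
      ι * v x k + - ((ι * height x) * v e k)         ≡⟨ cong (ι * v x k +_) (-‿distribˡ-* _ _) ⟩
      ι * v x k + - (ι * height x) * v e k           ∎
      where ι = inverse (scale x) (scale≢0 x≢e)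

    _≼_ : Subset n → Subset n → Set
    S ≼ T = ∀ {a} → a ∈ S → Span (T ∪ ⁅ e ⁆) (v a)

    span-≼ : ∀ {S T w} → S ≼ T → Span (S ∪ ⁅ e ⁆) w → Span (T ∪ ⁅ e ⁆) w
    span-≼ {S} {T} S≼T = span-trans λ a∈ → [ S≼T , span-∈ ∘ q⊆p∪q T ⁅ e ⁆ ] (x∈p∪q⁻ S ⁅ e ⁆ a∈)

    ⁅⁆-≼ : ∀ {x T} → Span (T ∪ ⁅ e ⁆) (v x) → ⁅ x ⁆ ≼ T
    ⁅⁆-≼ {x} {T} span a∈⁅x⁆ = subst (Span (T ∪ ⁅ e ⁆) ∘ v) (sym (x∈⁅y⁆⇒x≡y x a∈⁅x⁆)) span

    ≼-π : ∀ {S T} → (∀ {a} → a ∈ S → a ≢ e × π a ∈ T) → S ≼ T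
    ≼-π {T = T} a↦ a∈S = let a≢e , πa∈T = a↦ a∈S in
      span-mono (pair-⊆ (p⊆p∪q ⁅ e ⁆ πa∈T) (q⊆p∪q T ⁅ e ⁆ (x∈⁅x⁆ e))) (span-π a≢e)

    π-≼ : ∀ {S T} → (∀ {b} → b ∈ T → ∃[ a ] (a ∈ S × a ≢ e × π a ≡ b)) → T ≼ S
    π-≼ {S} b↤ b∈T with b↤ b∈T
    ... | a , a∈S , a≢e , refl =
      span-mono (pair-⊆ (p⊆p∪q ⁅ e ⁆ a∈S) (q⊆p∪q S ⁅ e ⁆ (x∈⁅x⁆ e))) (span-π⁻¹ a≢e)

    span⇔span-π : ∀ {x T} → x ≢ e → Span (T ∪ ⁅ e ⁆) (v x) ⇔ Span (T ∪ ⁅ e ⁆) (v (π x))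
    span⇔span-π x≢e = mk⇔ (λ span → span-≼ (⁅⁆-≼ span) (span-π⁻¹ x≢e))
                           (λ span → span-≼ (⁅⁆-≼ span) (span-π x≢e))

    span⇒π-≡ : ∀ {x y} → x ≢ e → y ≢ e → Span (⁅ x ⁆ ∪ ⁅ e ⁆) (v y) → π y ≡ π x
    span⇒π-≡ {x} {y} x≢e y≢e span with span-pair⁻ x≢e span
    ... | α , β , vy≗ with α ≟ 0#
    ...   | yes α≡0 = contradiction (sym (parallel⇒≡ β λ k → begin
      v y k                     ≡⟨ vy≗ k ⟩
      α * v x k + β * v e k     ≡⟨ cong (λ a → a * v x k + β * v e k) α≡0 ⟩
      0# * v x k + β * v e k    ≡⟨ cong (_+ β * v e k) (zeroˡ _) ⟩
      0# + β * v e k            ≡⟨ +-identityˡ _ ⟩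
      β * v e k                 ∎)) y≢e
    ...   | no α≢0 = π-unique y≢e (π-∈H x≢e) (*-≢0 α≢0 (scale≢0 x≢e)) λ k → begin
      v y k
        ≡⟨ vy≗ k ⟩
      α * v x k + β * v e k
        ≡⟨ cong (λ a → α * a + β * v e k) (π-decomposition x≢e k) ⟩
      α * (scale x * v (π x) k + height x * v e k) + β * v e k
        ≡⟨ cong (_+ β * v e k) (distribˡ α _ _) ⟩
      (α * (scale x * v (π x) k) + α * (height x * v e k)) + β * v e k
        ≡⟨ +-assoc _ _ _ ⟩
      α * (scale x * v (π x) k) + (α * (height x * v e k) + β * v e k)
        ≡⟨ cong₂ (λ a b → a + (b + β * v e k)) (*-assoc α _ _) (*-assoc α _ _) ⟨
      (α * scale x) * v (π x) k + ((α * height x) * v e k + β * v e k)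
        ≡⟨ cong ((α * scale x) * v (π x) k +_) (distribʳ (v e k) _ β) ⟨
      (α * scale x) * v (π x) k + (α * height x + β) * v e k
        ∎

    private
      ⁅x⁆∪⁅e⁆∪⁅y⁆⊆ : ∀ {x y} → (⁅ x ⁆ ∪ ⁅ e ⁆) ∪ ⁅ y ⁆ ⊆ ⁅ e ⁆ ∪ ⁅ x ⁆ ∪ ⁅ y ⁆
      ⁅x⁆∪⁅e⁆∪⁅y⁆⊆ {x} {y} =
        ∪-⊆ (pair-⊆ (q⊆p∪q ⁅ e ⁆ _ (p⊆p∪q ⁅ y ⁆ (x∈⁅x⁆ x))) (p⊆p∪q _ (x∈⁅x⁆ e)))
                                (⁅⁆-⊆ (q⊆p∪q ⁅ e ⁆ _ (q⊆p∪q ⁅ x ⁆ ⁅ y ⁆ (x∈⁅x⁆ y))))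

      ⊆⁅x⁆∪⁅e⁆∪⁅y⁆ : ∀ {x y} → ⁅ e ⁆ ∪ ⁅ x ⁆ ∪ ⁅ y ⁆ ⊆ (⁅ x ⁆ ∪ ⁅ e ⁆) ∪ ⁅ y ⁆
      ⊆⁅x⁆∪⁅e⁆∪⁅y⁆ {x} {y} =
        ∪-⊆ (⁅⁆-⊆ (p⊆p∪q ⁅ y ⁆ (q⊆p∪q ⁅ x ⁆ ⁅ e ⁆ (x∈⁅x⁆ e))))
            (pair-⊆ (p⊆p∪q ⁅ y ⁆ (p⊆p∪q ⁅ e ⁆ (x∈⁅x⁆ x))) (q⊆p∪q _ ⁅ y ⁆ (x∈⁅x⁆ y)))

    π-≡⇔dependent : ∀ {x y} → x ≢ y → x ≢ e → y ≢ e →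
                    π x ≡ π y ⇔ (¬ Independent (⁅ e ⁆ ∪ ⁅ x ⁆ ∪ ⁅ y ⁆))
    π-≡⇔dependent {x} {y} x≢y x≢e y≢e = mk⇔ to from
      where
      to : π x ≡ π y → ¬ Independent (⁅ e ⁆ ∪ ⁅ x ⁆ ∪ ⁅ y ⁆)
      to πx≡πy = span⇒¬independent∪ (∉-∪ (x≢y ∘ sym ∘ x∈⁅y⁆⇒x≡y x) (y≢e ∘ x∈⁅y⁆⇒x≡y e)) span-y
               ∘ independent-mono ⁅x⁆∪⁅e⁆∪⁅y⁆⊆
        where
        span-y : Span (⁅ x ⁆ ∪ ⁅ e ⁆) (v y)
        span-y = span-≼ (⁅⁆-≼ (span-π⁻¹ x≢e))
                        (subst (λ h → Span (⁅ h ⁆ ∪ ⁅ e ⁆) (v y)) (sym πx≡πy) (span-π y≢e))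
      from : ¬ Independent (⁅ e ⁆ ∪ ⁅ x ⁆ ∪ ⁅ y ⁆) → π x ≡ π y
      from ¬ind = sym (span⇒π-≡ x≢e y≢e
        (¬independent∪⇒span (independent-pair x≢e) (¬ind ∘ independent-mono ⊆⁅x⁆∪⁅e⁆∪⁅y⁆)))

    ∈flat⇔π-∈flat : ∀ {F x} → Flat F → e ∈ F → x ≢ e → x ∈ F ⇔ π x ∈ F
    ∈flat⇔π-∈flat flat e∈F x≢e = mk⇔
      (λ x∈F  → flat⇒span-closed flat (span-mono (pair-⊆ x∈F e∈F) (span-π⁻¹ x≢e)))
      (λ πx∈F → flat⇒span-closed flat (span-mono (pair-⊆ πx∈F e∈F) (span-π x≢e)))

    π-collision⇒centre-∈flat : ∀ {F x y} → Flat F → x ≢ y → x ≢ e → y ≢ e → π x ≡ π y →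
                               x ∈ F → y ∈ F → e ∈ F
    π-collision⇒centre-∈flat {x = x} {y} flat x≢y x≢e y≢e πx≡πy x∈F y∈F =
      flat⇒span-closed flat (span-mono (pair-⊆ x∈F y∈F)
        (¬independent∪⇒span (independent-pair x≢y)
          (Equivalence.to (π-≡⇔dependent x≢y x≢e y≢e) πx≡πy ∘ independent-mono ⊆triple)))
      where
      ⊆triple : ⁅ e ⁆ ∪ ⁅ x ⁆ ∪ ⁅ y ⁆ ⊆ (⁅ x ⁆ ∪ ⁅ y ⁆) ∪ ⁅ e ⁆
      ⊆triple = ∪-⊆ (⁅⁆-⊆ (q⊆p∪q _ ⁅ e ⁆ (x∈⁅x⁆ e))) (p⊆p∪q ⁅ e ⁆)

    span-H : ∀ {I w} → I ⊆ H → Span I w → w k₀ ≡ 0#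
    span-H {I} I⊆H (c , supp , w≗) = trans (w≗ k₀) (sum-zero term≡0)
      where
      term≡0 : ∀ i → c i * v i k₀ ≡ 0#
      term≡0 i with i ∈? I
      ... | yes i∈I = trans (cong (c i *_) (∈-subsetOf⁻ inH? (I⊆H i∈I))) (zeroʳ _)
      ... | no i∉I  = trans (cong (_* v i k₀) (supp i i∉I)) (zeroˡ _)

    H-flat : Flat H
    H-flat = span-closed⇒flat (∈-subsetOf⁺ inH? ∘ span-H id)

    independent-∪-centre⇔ : ∀ {B} → B ⊆ H → Independent (B ∪ ⁅ e ⁆) ⇔ Independent B
    independent-∪-centre⇔ B⊆H = mk⇔ (independent-mono (p⊆p∪q ⁅ e ⁆))
                                     (λ ind → ¬span⇒independent∪ ind (vek₀≢0 ∘ span-H B⊆H))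

    image-π⊆H : ∀ {A} → e ∉ A → image π A ⊆ H
    image-π⊆H {A} e∉A b∈ with ∈-image⁻ π b∈
    ... | a , a∈A , refl = π-∈H (λ a≡e → e∉A (subst (_∈ A) a≡e a∈A))

    -- A ∪ {e} is independent iff no a ∈ A is spanned by A - a together with e, and this
    -- condition is unchanged when every point is replaced by its projection.
    independent-∪-centre⇔image : ∀ {A} → e ∉ A → (∀ {a b} → a ∈ A → b ∈ A → π a ≡ π b → a ≡ b) →
                                 Independent (A ∪ ⁅ e ⁆) ⇔ Independent (image π A)
    independent-∪-centre⇔image {A} e∉A π-injective =
      ⇔-trans (independent-∪⇔¬span e∉A (nonzero e))
        (⇔-trans (mk⇔ to from)
          (⇔-trans (⇔-sym (independent-∪⇔¬span (e∉H ∘ image-π⊆H e∉A) (nonzero e)))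
            (independent-∪-centre⇔ (image-π⊆H e∉A))))
      where
      ≢e : ∀ {a} → a ∈ A → a ≢ e
      ≢e a∈A refl = e∉A a∈A

      A-a≼B-πa : ∀ {a} → a ∈ A → (A - a) ≼ (image π A - π a)
      A-a≼B-πa {a} a∈A = ≼-π λ a′∈ → let a′∈A = p─q⊆p A ⁅ a ⁆ a′∈ in
        ≢e a′∈A , x∈p∧x≢y⇒x∈p-y (∈-image⁺ π a′∈A) (x∈p-y⇒x≢y a′∈ ∘ π-injective a′∈A a∈A)

      B-πa≼A-a : ∀ {a} → a ∈ A → (image π A - π a) ≼ (A - a)
      B-πa≼A-a {a} a∈A = π-≼ λ b∈ → case ∈-image⁻ π (p─q⊆p (image π A) ⁅ π a ⁆ b∈) of λ where
        (a′ , a′∈A , refl) → a′ , x∈p∧x≢y⇒x∈p-y a′∈A (x∈p-y⇒x≢y b∈ ∘ cong π) , ≢e a′∈A , refl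

      to : (∀ {a} → a ∈ A → ¬ Span ((A - a) ∪ ⁅ e ⁆) (v a)) →
           ∀ {b} → b ∈ image π A → ¬ Span ((image π A - b) ∪ ⁅ e ⁆) (v b)
      to ¬span b∈B span with ∈-image⁻ π b∈B
      ... | a , a∈A , refl = ¬span a∈A (Equivalence.from (span⇔span-π (≢e a∈A)) (span-≼ (B-πa≼A-a a∈A) span))

      from : (∀ {b} → b ∈ image π A → ¬ Span ((image π A - b) ∪ ⁅ e ⁆) (v b)) →
             ∀ {a} → a ∈ A → ¬ Span ((A - a) ∪ ⁅ e ⁆) (v a)
      from ¬span a∈A span =
        ¬span (∈-image⁺ π a∈A) (span-≼ (A-a≼B-πa a∈A) (Equivalence.to (span⇔span-π (≢e a∈A)) span))

module ProjectedTarget {q : ℕ} (𝔽 : FiniteField q) {n r : ℕ} (v : Fin n → Fin r → Fin q)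
                       (pg : IsPG 𝔽 r v) (e : Fin n) where
  open Nat using (_+_; _*_; _∸_)
  open LinearAlgebra 𝔽 v
  open Layering 𝔽 v
  open ProjectiveGeometry 𝔽 v pg
  open Projection e

  module ProjectedLayering {X : Subset n} {k : ℕ} {F : ℕ → Subset n}
           (chain : ∀ i → i < k → F i ⊆ F (suc i)) (flats : ∀ i → i ≤ k → Flat (F i))
           (layers : ∀ x → x ∈ X ⇔ InEvenLayer k F x)
           {j jj : ℕ} (j<k : j < k) (j≡2jj : j ≡ 2 * jj) (e∈F[1+j] : e ∈ F (suc j)) (e∉F[j] : e ∉ F j) where

    -- Layer 0 of G collects the projections of layers ≤ j, layer t > 0 those of layer t + j.
    G : ℕ → Subset n
    G zero    = ⊥
    G (suc t) = F (suc t + j) ∩ H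

    G-pos : ∀ {t} → 0 < t → G t ≡ F (t + j) ∩ H
    G-pos {suc t} _ = refl

    G-chain : ∀ t → t < k ∸ j → G t ⊆ G (suc t)
    G-chain zero    _     p∈⊥ = contradiction p∈⊥ ∉⊥
    G-chain (suc t) t<k-j =
      ⊆-∩ (chain (suc t + j) (m≤o∸n⇒m+n≤o (suc (suc t)) (<⇒≤ j<k) t<k-j) ∘ p∩q⊆p _ H) (p∩q⊆q _ H)

    G-flat : ∀ t → t ≤ k ∸ j → Flat (G t)
    G-flat zero    _     = flat-⊥ nonzero
    G-flat (suc t) t≤k-j = flat-∩ (flats (suc t + j) (m≤o∸n⇒m+n≤o (suc t) (<⇒≤ j<k) t≤k-j)) H-flat

    π-∈image : ∀ {x} → x ∈ X → x ≢ e → π x ∈ image π (X - e)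
    π-∈image x∈X x≢e = ∈-image⁺ π (x∈p∧x≢y⇒x∈p-y x∈X x≢e)

    π-layer : ∀ {x} → x ∈ X → x ≢ e → InEvenLayer (k ∸ j) G (π x)
    π-layer {x} x∈X x≢e with Equivalence.to (layers x) x∈X
    ... | ℓ , ℓ<k , (ℓℓ , ℓ≡2ℓℓ) , x∈F[1+ℓ] , x∉F[ℓ] with j <? ℓ
    ...   | no j≮ℓ = 0 , m<n⇒0<n∸m j<k , (0 , refl) , x∈p∩q⁺ (πx∈F[1+j] , π-∈H x≢e) , ∉⊥
      where
      πx∈F[1+j] : π x ∈ F (suc j)
      πx∈F[1+j] = Equivalence.to (∈flat⇔π-∈flat (flats (suc j) j<k) e∈F[1+j] x≢e)
                                 (chain-mono chain (s≤s (≮⇒≥ j≮ℓ)) j<k x∈F[1+ℓ])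
    ...   | yes j<ℓ = ℓ ∸ j , ∸-monoˡ-< ℓ<k (<⇒≤ j<ℓ) , (ℓℓ ∸ jj , ℓ-j≡2[ℓℓ-jj]) ,
                      x∈p∩q⁺ (πx∈F[1+ℓ] , π-∈H x≢e) , πx∉G[ℓ-j]
      where
      ℓ-j+j≡ℓ : ℓ ∸ j + j ≡ ℓ
      ℓ-j+j≡ℓ = m∸n+n≡m (<⇒≤ j<ℓ)

      ℓ-j≡2[ℓℓ-jj] : ℓ ∸ j ≡ 2 * (ℓℓ ∸ jj)
      ℓ-j≡2[ℓℓ-jj] = trans (cong₂ _∸_ ℓ≡2ℓℓ j≡2jj) (sym (*-distribˡ-∸ 2 ℓℓ jj))

      πx∈F[1+ℓ] : π x ∈ F (suc (ℓ ∸ j + j))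
      πx∈F[1+ℓ] = subst (λ i → π x ∈ F (suc i)) (sym ℓ-j+j≡ℓ)
        (Equivalence.to (∈flat⇔π-∈flat (flats (suc ℓ) ℓ<k) e∈F[1+ℓ] x≢e) x∈F[1+ℓ])
        where
        e∈F[1+ℓ] : e ∈ F (suc ℓ)
        e∈F[1+ℓ] = chain-mono chain (s≤s (<⇒≤ j<ℓ)) ℓ<k e∈F[1+j]

      πx∉G[ℓ-j] : π x ∉ G (ℓ ∸ j)
      πx∉G[ℓ-j] πx∈G = x∉F[ℓ] (Equivalence.from (∈flat⇔π-∈flat (flats ℓ (<⇒≤ ℓ<k)) e∈F[ℓ] x≢e)
        (subst (λ i → π x ∈ F i) ℓ-j+j≡ℓ (p∩q⊆p _ H (subst (π x ∈_) (G-pos (m<n⇒0<n∸m j<ℓ)) πx∈G))))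
        where
        e∈F[ℓ] : e ∈ F ℓ
        e∈F[ℓ] = chain-mono chain j<ℓ (<⇒≤ ℓ<k) e∈F[1+j]

    fibre⊆image : ∀ {p x} → p ∈ F (suc j) → p ∈ F j → p ∈ H → x ≢ e → x ≢ p → π x ≡ p → p ∈ image π (X - e)
    fibre⊆image {p} {x} p∈F[1+j] p∈F[j] p∈H x≢e x≢p πx≡p =
      subst (_∈ image π (X - e)) πx≡p (π-∈image x∈X x≢e)
      where
      x∈F[1+j] : x ∈ F (suc j)
      x∈F[1+j] = Equivalence.from (∈flat⇔π-∈flat (flats (suc j) j<k) e∈F[1+j] x≢e)
                                  (subst (_∈ F (suc j)) (sym πx≡p) p∈F[1+j])

      x∉F[j] : x ∉ F j
      x∉F[j] x∈F[j] = e∉F[j] (π-collision⇒centre-∈flat (flats j (<⇒≤ j<k)) x≢p x≢e (∈H⇒≢e p∈H)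
                                (trans πx≡p (sym (π-fixes-H p∈H))) x∈F[j] p∈F[j])

      x∈X : x ∈ X
      x∈X = Equivalence.from (layers x) (j , j<k , (jj , j≡2jj) , x∈F[1+j] , x∉F[j])

    bottom-layer⊆image : ∀ {p} → p ∈ F (suc j) → p ∈ H → p ∈ image π (X - e)
    bottom-layer⊆image {p} p∈F[1+j] p∈H = case p ∈? F j of λ where
      (no p∉F[j])  → subst (_∈ image π (X - e)) (π-fixes-H p∈H)
                       (π-∈image (Equivalence.from (layers p) (j , j<k , (jj , j≡2jj) , p∈F[1+j] , p∉F[j])) (∈H⇒≢e p∈H))
      (yes p∈F[j]) → let x , x≢e , x≢p , πx≡p = π-fibre p∈H in
                     fibre⊆image p∈F[1+j] p∈F[j] p∈H x≢e x≢p πx≡p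

    layer⊆image : ∀ {p} → InEvenLayer (k ∸ j) G p → p ∈ image π (X - e)
    layer⊆image (zero , _ , _ , p∈G[1] , _) = bottom-layer⊆image (p∩q⊆p _ H p∈G[1]) (p∩q⊆q _ H p∈G[1])
    layer⊆image {p} (suc t , 1+t<k-j , (a , 1+t≡2a) , p∈G , p∉G) =
      subst (_∈ image π (X - e)) (π-fixes-H p∈H) (π-∈image p∈X (∈H⇒≢e p∈H))
      where
      p∈H : p ∈ H
      p∈H = p∩q⊆q _ H p∈G

      p∈X : p ∈ X
      p∈X = Equivalence.from (layers p)
        (suc t + j , m≤o∸n⇒m+n≤o (suc (suc t)) (<⇒≤ j<k) 1+t<k-j ,
         (a + jj , trans (cong₂ _+_ 1+t≡2a j≡2jj) (sym (*-distribˡ-+ 2 a jj))) ,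
         p∩q⊆p _ H p∈G , λ p∈F → p∉G (x∈p∩q⁺ (p∈F , p∈H)))

    G-layers : ∀ p → p ∈ image π (X - e) ⇔ InEvenLayer (k ∸ j) G p
    G-layers p = mk⇔ to layer⊆image
      where
      to : p ∈ image π (X - e) → InEvenLayer (k ∸ j) G p
      to p∈ with ∈-image⁻ π p∈
      ... | x , x∈X-e , refl = π-layer (p─q⊆p X ⁅ e ⁆ x∈X-e) (x∈p-y⇒x≢y x∈X-e)

  project-targetSet : ∀ {X} → IsTargetSet 𝔽 v X → e ∈ X → IsTargetSet 𝔽 v (image π (X - e))
  project-targetSet (k , F , _ , _ , chain , flats , layers) e∈X with Equivalence.to (layers e) e∈X
  ... | j , j<k , (jj , j≡2jj) , e∈F[1+j] , e∉F[j] =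
    layered⇒targetSet (k ∸ j , G , (λ _ → ∉⊥) , G-chain , G-flat , G-layers)
    where open ProjectedLayering chain flats layers {jj = jj} j<k j≡2jj e∈F[1+j] e∉F[j]

module ContractionStep {q : ℕ} (𝔽 : FiniteField q) {k m n r : ℕ} {L : Matroid m} {N : Matroid k}
         {v : Fin n → Fin r → Fin q} (pg : IsPG 𝔽 r v)
         {X : Subset n} (ψiso : IsoToRestriction (Indep L) (LinIndep 𝔽 v) X)
         {e′ : Fin m} {Z : Subset m} (e′∉Z : e′ ∉ Z)
         (cover : ∀ f → f ≢ e′ → ∃[ x ] (x ∈ Z × (f ≡ x ⊎ ¬ Indep L (⁅ e′ ⁆ ∪ ⁅ f ⁆ ∪ ⁅ x ⁆))))
         (triple-independent : ∀ x y → x ∈ Z → y ∈ Z → x ≢ y → Indep L (⁅ e′ ⁆ ∪ ⁅ x ⁆ ∪ ⁅ y ⁆))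
         (φiso : IsoToRestriction (Indep N) (λ I → Indep L (I ∪ ⁅ e′ ⁆)) Z) where
  open LinearAlgebra 𝔽 v using (Independent)
  open ProjectiveGeometry 𝔽 v pg using (module Projection)
  module Ψ = RestrictionIso {IndN = Indep L} {IndM = Independent} ψiso
  module Φ = RestrictionIso {IndN = Indep N} {IndM = λ I → Indep L (I ∪ ⁅ e′ ⁆)} φiso

  ψ : Fin m → Fin n
  ψ = Ψ.φ

  e : Fin n
  e = ψ e′

  open Projection e

  X/e : Subset n
  X/e = image π (X - e)

  ∈Z⇒≢e′ : ∀ {a} → a ∈ Z → a ≢ e′
  ∈Z⇒≢e′ a∈Z refl = e′∉Z a∈Z

  ψ-≢e : ∀ {a} → a ≢ e′ → ψ a ≢ e
  ψ-≢e a≢e′ = a≢e′ ∘ Ψ.φ-injective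

  triple⇔ : ∀ a b → Indep L (⁅ e′ ⁆ ∪ ⁅ a ⁆ ∪ ⁅ b ⁆) ⇔ Independent (⁅ e ⁆ ∪ ⁅ ψ a ⁆ ∪ ⁅ ψ b ⁆)
  triple⇔ a b = subst (λ S → Indep L (⁅ e′ ⁆ ∪ ⁅ a ⁆ ∪ ⁅ b ⁆) ⇔ Independent S) image-triple
                      (⇔-sym (Ψ.independent-image _))
    where
    image-triple : image ψ (⁅ e′ ⁆ ∪ ⁅ a ⁆ ∪ ⁅ b ⁆) ≡ ⁅ e ⁆ ∪ ⁅ ψ a ⁆ ∪ ⁅ ψ b ⁆
    image-triple = trans (image-∪ ψ _ _) (cong₂ _∪_ (image-⁅⁆ ψ e′)
                         (trans (image-∪ ψ _ _) (cong₂ _∪_ (image-⁅⁆ ψ a) (image-⁅⁆ ψ b))))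

  ρ : Fin m → Fin n
  ρ = π ∘ ψ

  ρ-injective : ∀ {a b} → a ∈ Z → b ∈ Z → ρ a ≡ ρ b → a ≡ b
  ρ-injective {a} {b} a∈Z b∈Z ρa≡ρb with a ≟ b
  ... | yes a≡b = a≡b
  ... | no a≢b  = contradiction (Equivalence.to (triple⇔ a b) (triple-independent a b a∈Z b∈Z a≢b))
                    (Equivalence.to (π-≡⇔dependent (a≢b ∘ Ψ.φ-injective) (ψ-≢e (∈Z⇒≢e′ a∈Z)) (ψ-≢e (∈Z⇒≢e′ b∈Z)))
                                    ρa≡ρb)

  image-ρ : image ρ Z ≡ X/e
  image-ρ = ⊆-antisym to from
    where
    to : image ρ Z ⊆ X/e
    to y∈ with ∈-image⁻ ρ y∈
    ... | z , z∈Z , refl = ∈-image⁺ π (x∈p∧x≢y⇒x∈p-y (Ψ.φ-∈ z) (ψ-≢e (∈Z⇒≢e′ z∈Z)))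

    from : X/e ⊆ image ρ Z
    from y∈ with ∈-image⁻ π y∈
    ... | x , x∈X-e , refl with Equivalence.to (Ψ.∈X⇔∈range x) (p─q⊆p X ⁅ e ⁆ x∈X-e)
    ...   | f , refl with cover f (x∈p-y⇒x≢y x∈X-e ∘ cong ψ)
    ...     | z , z∈Z , inj₁ refl = ∈-image⁺ ρ z∈Z
    ...     | z , z∈Z , inj₂ ¬ind with f ≟ z
    ...       | yes refl = ∈-image⁺ ρ z∈Z
    ...       | no f≢z   = subst (_∈ image ρ Z) (sym ρf≡ρz) (∈-image⁺ ρ z∈Z)
      where
      ρf≡ρz : ρ f ≡ ρ z
      ρf≡ρz = Equivalence.from (π-≡⇔dependent (f≢z ∘ Ψ.φ-injective) (x∈p-y⇒x≢y x∈X-e) (ψ-≢e (∈Z⇒≢e′ z∈Z)))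
                               (¬ind ∘ Equivalence.from (triple⇔ f z))

  independent⇔ : ∀ I → I ⊆ image ρ Z → Independent I ⇔ Indep N (preimage (ρ ∘ Φ.φ) I)
  independent⇔ I I⊆ = begin
    Independent I
      ≡⟨ cong Independent (trans (sym (image-preimage ρ I⊆)) (image-∘ ψ π T)) ⟩
    Independent (image π (image ψ T))
      ≈⟨ independent-∪-centre⇔image e∉ψT π-injective ⟨
    Independent (image ψ T ∪ ⁅ e ⁆)
      ≡⟨ cong Independent (trans (cong (image ψ T ∪_) (sym (image-⁅⁆ ψ e′))) (sym (image-∪ ψ T ⁅ e′ ⁆))) ⟩
    Independent (image ψ (T ∪ ⁅ e′ ⁆))
      ≈⟨ Ψ.independent-image (T ∪ ⁅ e′ ⁆) ⟩
    Indep L (T ∪ ⁅ e′ ⁆)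
      ≈⟨ Φ.independent⇔ T (p∩q⊆p Z _) ⟩
    Indep N (preimage Φ.φ T)
      ≡⟨ cong (Indep N) preimage-T ⟩
    Indep N (preimage (ρ ∘ Φ.φ) I)
      ∎
    where
    open SetoidReasoning (⇔-setoid 0ℓ)

    T : Subset m
    T = Z ∩ preimage ρ I

    e∉ψT : e ∉ image ψ T
    e∉ψT e∈ with ∈-image⁻ ψ e∈
    ... | a , a∈T , ψa≡e = ψ-≢e (∈Z⇒≢e′ (p∩q⊆p Z _ a∈T)) ψa≡e

    π-injective : ∀ {a b} → a ∈ image ψ T → b ∈ image ψ T → π a ≡ π b → a ≡ b
    π-injective a∈ b∈ πa≡πb with ∈-image⁻ ψ a∈ | ∈-image⁻ ψ b∈
    ... | a′ , a′∈T , refl | b′ , b′∈T , refl =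
      cong ψ (ρ-injective (p∩q⊆p Z _ a′∈T) (p∩q⊆p Z _ b′∈T) πa≡πb)

    preimage-T : preimage Φ.φ T ≡ preimage (ρ ∘ Φ.φ) I
    preimage-T = ⊆-antisym
      (∈-preimage⁺ (ρ ∘ Φ.φ) {I} ∘ ∈-preimage⁻ ρ {I} ∘ p∩q⊆q Z _ ∘ ∈-preimage⁻ Φ.φ {T})
      (λ {i} i∈ → ∈-preimage⁺ Φ.φ {T}
                    (x∈p∩q⁺ (Φ.φ-∈ i , ∈-preimage⁺ ρ {I} (∈-preimage⁻ (ρ ∘ Φ.φ) {I} i∈))))

  contraction-iso : IsoToRestriction (Indep N) Independent (image ρ Z)
  contraction-iso = ρ ∘ Φ.φ , injective , range , independent⇔
    where
    injective : ∀ {i j} → ρ (Φ.φ i) ≡ ρ (Φ.φ j) → i ≡ j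
    injective {i} {j} = Φ.φ-injective ∘ ρ-injective (Φ.φ-∈ i) (Φ.φ-∈ j)

    range : ∀ y → y ∈ image ρ Z ⇔ (∃[ i ] ρ (Φ.φ i) ≡ y)
    range y = mk⇔ to λ (i , ρφi≡y) → subst (_∈ image ρ Z) ρφi≡y (∈-image⁺ ρ (Φ.φ-∈ i))
      where
      to : y ∈ image ρ Z → ∃[ i ] ρ (Φ.φ i) ≡ y
      to y∈ with ∈-image⁻ ρ y∈
      ... | z , z∈Z , refl with Equivalence.to (Φ.∈X⇔∈range z) z∈Z
      ...   | i , refl = i , refl

module _ {q : ℕ} (𝔽 : FiniteField q) where

  simple-contraction-target : ∀ {k m} {L : Matroid m} {N : Matroid k} →
                              IsTarget 𝔽 L → IsSimpleContraction N L → IsTarget 𝔽 N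
  simple-contraction-target {L = L} {N} (r , n , v , pg , X , targetX , ψiso)
                            (e′ , Z , e′∉Z , cover , triple-independent , φiso) =
    r , n , v , pg , X/e , project-targetSet targetX (Ψ.φ-∈ e′) ,
    subst (IsoToRestriction (Indep N) (LinIndep 𝔽 v)) image-ρ contraction-iso
    where
    open ContractionStep 𝔽 {L = L} {N} pg ψiso e′∉Z cover triple-independent φiso
    open ProjectedTarget 𝔽 v pg e using (project-targetSet)

corollary2p5 : (q : ℕ) → IsPrimePower q → (𝔽 : FiniteField q) →
    ∀ {m n} (M : Matroid n) (N : Matroid m) →
    IsTarget 𝔽 M → InducedMinor N M → IsTarget 𝔽 N
corollary2p5 q _ 𝔽 M .M targetM (im-refl .M) = targetM
corollary2p5 q pp 𝔽 M N targetM (im-restr {L = L} L≤M restriction) =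
  induced-restriction-target 𝔽 {L = L} {N} (corollary2p5 q pp 𝔽 M L targetM L≤M) restriction
corollary2p5 q pp 𝔽 M N targetM (im-contr {L = L} L≤M contraction) =
  simple-contraction-target 𝔽 {L = L} {N} (corollary2p5 q pp 𝔽 M L targetM L≤M) contraction
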